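{- Let $a_1,\ldots,a_n\in\mathbb{R}^d$ and $z\in\mathbb{R}^d$. Let (Unit LP) be: maximize $\langle z,x\rangle$ subject to $\langle a_i,x\rangle\le1$ for $i=1,\ldots,n$. Let $a_{n+1},\ldots,a_{n+d}\in\mathbb{R}^d$, and let (Unit LP$^+$) be: maximize $\langle z,x\rangle$ subject to $\langle a_i,x\rangle\le 1$ for $i=1,\ldots,n+d$. (i) If $a_{n+1},\ldots,a_{n+d}$ all lie in some numb half-space of (Unit LP), then (Unit LP$^+$) is equivalent to (Unit LP). (ii) (Unit LP$^+$) is equivalent to (Unit LP) if and only if one of the following holds: (Unit LP$^+$) is unbounded, or none of the added constraints $\langle a_i,x\rangle\le1$, $i=n+1,\ldots,n+d$, holds with equality at its solution $x$.
   Context: Two linear programs are equivalent if one is bounded if and only if the other is, and, when bounded, they have the same solution. The numb set of a unit linear program is the set of all $a$ such that adding the constraint $\langle a,x\rangle\le1$ produces an equivalent program. A numb half-space is a half-space $\{x:\langle v,x\rangle\le0\}$ ($v\ne0$) contained in the numb set. Standing assumption: all constraint vectors are in general position, so a bounded program has a unique optimal vertex determined by $d$ tight constraints. The paper identifies a solution with the index set of constraints that are tight at it. -}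

module Defs where

open import Level using (0ℓ)
open import Data.Nat using (ℕ; suc)
import Data.Nat as ℕ
open import Data.Fin using (Fin; zero; suc; splitAt)
open import Data.Product using (Σ; ∃; _×_; _,_)
open import Data.Sum using (_⊎_; inj₁; inj₂; [_,_]′)
open import Data.Empty using (⊥)
open import Relation.Nullary using (¬_)
open import Relation.Binary.PropositionalEquality using (_≡_; _≢_)
open import Relation.Binary.Core using (Rel)
open import Relation.Binary.Structures using (IsStrictTotalOrder)
open import Algebra.Structures using (IsCommutativeRing)
open import Function.Definitions using (Injective)
open import Function.Bundles using (_⇔_)

-- The real numbers, given axiomatically as a complete ordered field
-- (any model of these axioms is isomorphic to ℝ).

record RealNumbers : Set₁ where
  infixl 7 _*_
  infixl 6 _+_
  infix 4 _<_
  field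
    ℝ    : Set
    0# 1# : ℝ
    _+_ _*_ : ℝ → ℝ → ℝ
    -_   : ℝ → ℝ
    _<_  : Rel ℝ 0ℓ
    isCommutativeRing : IsCommutativeRing _≡_ _+_ _*_ -_ 0# 1#
    0≢1      : 0# ≢ 1#
    inverse  : ∀ x → x ≢ 0# → Σ ℝ (λ y → x * y ≡ 1#)
    isStrictTotalOrder : IsStrictTotalOrder _≡_ _<_
    +-mono-< : ∀ {x y} z → x < y → x + z < y + z
    *-pos    : ∀ {x y} → 0# < x → 0# < y → 0# < x * y

  infix 4 _≤_
  _≤_ : ℝ → ℝ → Set
  x ≤ y = x < y ⊎ x ≡ y

  field
    completeness : (S : ℝ → Set) → Σ ℝ S →
                   Σ ℝ (λ u → ∀ s → S s → s ≤ u) →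
                   Σ ℝ (λ σ → (∀ s → S s → s ≤ σ) ×
                              (∀ u → (∀ s → S s → s ≤ u) → σ ≤ u))

module UnitLP (R : RealNumbers) where
  open RealNumbers R

  Vec : ℕ → Set
  Vec d = Fin d → ℝ

  zeroV : ∀ {d} → Vec d
  zeroV _ = 0#

  Σ[_] : ∀ {k} → (Fin k → ℝ) → ℝ
  Σ[_] {ℕ.zero} f = 0#
  Σ[_] {suc k} f = f zero + Σ[ (λ i → f (suc i)) ]

  ⟨_,_⟩ : ∀ {d} → Vec d → Vec d → ℝ
  ⟨ u , v ⟩ = Σ[ (λ i → u i * v i) ]

  Feasible : ∀ {d m} → (Fin m → Vec d) → Vec d → Set
  Feasible a x = ∀ i → ⟨ a i , x ⟩ ≤ 1#

  Bounded : ∀ {d m} → (Fin m → Vec d) → Vec d → Set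
  Bounded a z = Σ ℝ (λ M → ∀ x → Feasible a x → ⟨ z , x ⟩ ≤ M)

  Optimal : ∀ {d m} → (Fin m → Vec d) → Vec d → Vec d → Set
  Optimal a z x = Feasible a x × (∀ y → Feasible a y → ⟨ z , y ⟩ ≤ ⟨ z , x ⟩)

  Equivalent : ∀ {d m m'} → (Fin m → Vec d) → (Fin m' → Vec d) → Vec d → Set
  Equivalent a b z =
    (Bounded a z ⇔ Bounded b z) ×
    (Bounded a z → ∀ x → (Optimal a z x ⇔ Optimal b z x))

  _++ᶜ_ : ∀ {d m k} → (Fin m → Vec d) → (Fin k → Vec d) → Fin (m ℕ.+ k) → Vec d
  _++ᶜ_ {m = m} a b i = [ a , b ]′ (splitAt m i)

  addOne : ∀ {d m} → (Fin m → Vec d) → Vec d → Fin (suc m) → Vec d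
  addOne a c zero    = c
  addOne a c (suc i) = a i

  NumbSet : ∀ {d m} → (Fin m → Vec d) → Vec d → Vec d → Set
  NumbSet a z c = Equivalent a (addOne a c) z

  NumbHalfSpace : ∀ {d m} → (Fin m → Vec d) → Vec d → Vec d → Set
  NumbHalfSpace a z v =
    (v ≢ zeroV) × (∀ c → ⟨ v , c ⟩ ≤ 0# → NumbSet a z c)

  GeneralPosition : ∀ {d m} → (Fin m → Vec d) → Set
  GeneralPosition {d} {m} w =
    (∀ k → k ℕ.≤ d → (f : Fin k → Fin m) → Injective _≡_ _≡_ f →
       (c : Fin k → ℝ) →
       (∀ t → Σ[ (λ j → c j * w (f j) t) ] ≡ 0#) → ∀ j → c j ≡ 0#) ×
    (∀ (x : Vec d) (f : Fin (suc d) → Fin m) → Injective _≡_ _≡_ f →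
       ¬ (∀ j → ⟨ w (f j) , x ⟩ ≡ 1#))

-- In general position a bounded unit LP has a unique optimum, exactly d constraints are tight
-- there, and z is a nonnegative combination of their vectors (no improving direction exists at
-- the optimum).  The optimum exists up to double negation: from any feasible point one climbs to
-- a vertex, a point with d tight constraints, and vertices are determined by their tight sets, of
-- which there are finitely many.
-- (ii) If the added constraints are slack at the optimum of the enlarged program, it stays
-- locally, hence globally, optimal without them, and uniqueness carries optima of the original
-- program back.  Conversely, an added constraint tight at the common optimum would be a (d+1)-st
-- tight constraint there, which general position forbids.
-- (i) Split the nonnegative combination for z into the part coming from the original constraints
-- and the part c coming from the added ones.  Then c lies in the numb half-space, and adding the
-- single constraint ⟨c,x⟩ ≤ 1 already bounds the objective; so the original program is bounded,
-- and numbness keeps its optimum feasible for every added constraint.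
module Submission where

open import Defs
open import Level using (0ℓ)
open import Data.Nat as ℕ using (ℕ; zero; suc)
import Data.Nat.Properties as ℕ
open import Data.Fin as Fin using (Fin; zero; suc; punchIn; punchOut; inject≤; lift; splitAt; _↑ˡ_; _↑ʳ_)
import Data.Fin.Properties as Fin
open import Data.Product using (Σ; _×_; _,_; proj₁; proj₂)
open import Data.Sum as Sum using (_⊎_; inj₁; inj₂; [_,_]′)
open import Data.Empty using (⊥-elim)
open import Function using (_∘_; case_of_)
open import Function.Definitions using (Injective)
open import Function.Bundles using (_⇔_; mk⇔; Equivalence)
open import Relation.Nullary using (¬_; Dec; yes; no; does; contradiction; ¬?)
open import Relation.Nullary.Negation using (¬¬-Monad; ¬¬-map)
open import Relation.Nullary.Decidable using (decidable-stable; dec-true; ¬¬-excluded-middle)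
open import Relation.Binary.PropositionalEquality
open import Algebra.Bundles using (CommutativeRing)

-- The ring solver decides equality of normal forms by computing with their coefficients, which
-- the abstract reals do not allow; coefficients are therefore integers, mapped into ℝ.
module RingSolver (R : RealNumbers) where
  open import Data.Integer as ℤ using (ℤ; -[1+_]; sign; ∣_∣)
  import Data.Integer.Properties as ℤ
  open import Data.Sign as Sign using (Sign)
  open import Data.Maybe using (Maybe; just; nothing)
  open import Algebra.Bundles using (RawRing)
  open import Algebra.Solver.Ring.AlmostCommutativeRing
    using (AlmostCommutativeRing; fromCommutativeRing; _-Raw-AlmostCommutative⟶_)
  open RealNumbers R

  commutativeRing : CommutativeRing 0ℓ 0ℓ
  commutativeRing = record { isCommutativeRing = isCommutativeRing }

  open CommutativeRing commutativeRing using (semiring; ring; +-abelianGroup; *-commutativeSemigroup;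
    +-identityˡ; +-identityʳ; *-identityˡ; *-identityʳ; -‿inverseʳ; zeroʳ)
  open import Algebra.Properties.Ring ring using (-‿involutive; -‿distribˡ-*; -0#≈0#)
  open import Algebra.Properties.AbelianGroup +-abelianGroup using (⁻¹-∙-comm)
  open import Algebra.Properties.CommutativeSemigroup *-commutativeSemigroup
    using () renaming (interchange to *-interchange)
  open import Algebra.Properties.Semiring.Mult semiring using (×-homo-+; ×1-homo-*) renaming (_×_ to _×ₙ_)
  open import Algebra.Properties.CommutativeSemigroup (CommutativeRing.+-commutativeSemigroup commutativeRing)
    using () renaming (interchange to +-interchange)
  open ≡-Reasoning

  ⟦_⟧ : ℤ → ℝ
  ⟦ ℤ.+ n ⟧ = n ×ₙ 1#
  ⟦ -[1+ n ] ⟧ = - (suc n ×ₙ 1#)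

  ⟦_⟧ˢ : Sign → ℝ
  ⟦ Sign.+ ⟧ˢ = 1#
  ⟦ Sign.- ⟧ˢ = - 1#

  -‿homo : ∀ i → ⟦ ℤ.- i ⟧ ≡ - ⟦ i ⟧
  -‿homo (ℤ.+ zero) = sym -0#≈0#
  -‿homo (ℤ.+ suc n) = refl
  -‿homo -[1+ n ] = sym (-‿involutive _)

  ⊖-homo : ∀ m n → ⟦ m ℤ.⊖ n ⟧ ≡ m ×ₙ 1# + - (n ×ₙ 1#)
  ⊖-homo zero zero = sym (-‿inverseʳ 0#)
  ⊖-homo zero (suc n) = sym (+-identityˡ _)
  ⊖-homo (suc m) zero = sym (trans (cong ((suc m ×ₙ 1#) +_) -0#≈0#) (+-identityʳ _))
  ⊖-homo (suc m) (suc n) = begin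
    ⟦ suc m ℤ.⊖ suc n ⟧           ≡⟨ cong ⟦_⟧ (ℤ.[1+m]⊖[1+n]≡m⊖n m n) ⟩
    ⟦ m ℤ.⊖ n ⟧                   ≡⟨ ⊖-homo m n ⟩
    m ×ₙ 1# + - (n ×ₙ 1#)           ≡⟨ sym (+-identityˡ _) ⟩
    0# + (m ×ₙ 1# + - (n ×ₙ 1#))    ≡⟨ cong (_+ (m ×ₙ 1# + - (n ×ₙ 1#))) (sym (-‿inverseʳ 1#)) ⟩
    (1# + - 1#) + (m ×ₙ 1# + - (n ×ₙ 1#)) ≡⟨ +-interchange 1# (- 1#) (m ×ₙ 1#) (- (n ×ₙ 1#)) ⟩
    suc m ×ₙ 1# + (- 1# + - (n ×ₙ 1#)) ≡⟨ cong ((suc m ×ₙ 1#) +_) (⁻¹-∙-comm 1# (n ×ₙ 1#)) ⟩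
    suc m ×ₙ 1# + - (suc n ×ₙ 1#)   ∎

  +-homo : ∀ i j → ⟦ i ℤ.+ j ⟧ ≡ ⟦ i ⟧ + ⟦ j ⟧
  +-homo -[1+ m ] -[1+ n ] = begin
    - (suc (suc (m ℕ.+ n)) ×ₙ 1#)    ≡⟨ cong (λ k → - (suc k ×ₙ 1#)) (sym (ℕ.+-suc m n)) ⟩
    - ((suc m ℕ.+ suc n) ×ₙ 1#)      ≡⟨ cong -_ (×-homo-+ 1# (suc m) (suc n)) ⟩
    - (suc m ×ₙ 1# + suc n ×ₙ 1#)     ≡⟨ sym (⁻¹-∙-comm _ _) ⟩
    - (suc m ×ₙ 1#) + - (suc n ×ₙ 1#) ∎
  +-homo -[1+ m ] (ℤ.+ n) = trans (⊖-homo n (suc m)) (CommutativeRing.+-comm commutativeRing _ _)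
  +-homo (ℤ.+ m) -[1+ n ] = ⊖-homo m (suc n)
  +-homo (ℤ.+ m) (ℤ.+ n) = ×-homo-+ 1# m n

  ◃-homo : ∀ s n → ⟦ s ℤ.◃ n ⟧ ≡ ⟦ s ⟧ˢ * (n ×ₙ 1#)
  ◃-homo s zero = sym (zeroʳ _)
  ◃-homo Sign.+ (suc n) = sym (*-identityˡ _)
  ◃-homo Sign.- (suc n) = trans (cong -_ (sym (*-identityˡ _))) (-‿distribˡ-* 1# _)

  sign-abs : ∀ i → ⟦ i ⟧ ≡ ⟦ sign i ⟧ˢ * (∣ i ∣ ×ₙ 1#)
  sign-abs i = trans (cong ⟦_⟧ (sym (ℤ.◃-inverse i))) (◃-homo (sign i) ∣ i ∣)

  sign-*-homo : ∀ s t → ⟦ s Sign.* t ⟧ˢ ≡ ⟦ s ⟧ˢ * ⟦ t ⟧ˢ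
  sign-*-homo Sign.- Sign.- =
    sym (trans (sym (-‿distribˡ-* 1# (- 1#))) (trans (cong -_ (*-identityˡ _)) (-‿involutive 1#)))
  sign-*-homo Sign.- Sign.+ = sym (*-identityʳ _)
  sign-*-homo Sign.+ t = sym (*-identityˡ _)

  *-homo : ∀ i j → ⟦ i ℤ.* j ⟧ ≡ ⟦ i ⟧ * ⟦ j ⟧
  *-homo i j = begin
    ⟦ sign i Sign.* sign j ℤ.◃ ∣ i ∣ ℕ.* ∣ j ∣ ⟧                    ≡⟨ ◃-homo _ (∣ i ∣ ℕ.* ∣ j ∣) ⟩
    ⟦ sign i Sign.* sign j ⟧ˢ * ((∣ i ∣ ℕ.* ∣ j ∣) ×ₙ 1#)          ≡⟨ cong₂ _*_ (sign-*-homo (sign i) (sign j))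
                                                                        (×1-homo-* ∣ i ∣ ∣ j ∣) ⟩
    (⟦ sign i ⟧ˢ * ⟦ sign j ⟧ˢ) * ((∣ i ∣ ×ₙ 1#) * (∣ j ∣ ×ₙ 1#))  ≡⟨ *-interchange _ _ _ _ ⟩
    (⟦ sign i ⟧ˢ * (∣ i ∣ ×ₙ 1#)) * (⟦ sign j ⟧ˢ * (∣ j ∣ ×ₙ 1#))  ≡⟨ sym (cong₂ _*_ (sign-abs i) (sign-abs j)) ⟩
    ⟦ i ⟧ * ⟦ j ⟧                                                  ∎

  ℤ-rawRing : RawRing 0ℓ 0ℓ
  ℤ-rawRing = record
    { Carrier = ℤ ; _≈_ = _≡_ ; _+_ = ℤ._+_ ; _*_ = ℤ._*_ ; -_ = ℤ.-_ ; 0# = ℤ.+ 0 ; 1# = ℤ.+ 1 }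

  ℝ-almostCommutativeRing : AlmostCommutativeRing 0ℓ 0ℓ
  ℝ-almostCommutativeRing = fromCommutativeRing commutativeRing

  ℤ⟶ℝ : ℤ-rawRing -Raw-AlmostCommutative⟶ ℝ-almostCommutativeRing
  ℤ⟶ℝ = record
    { ⟦_⟧ = ⟦_⟧ ; +-homo = +-homo ; *-homo = *-homo ; -‿homo = -‿homo ; 0-homo = refl ; 1-homo = +-identityʳ 1# }

  ⟦⟧-weaklyDecidable : ∀ i j → Maybe (⟦ i ⟧ ≡ ⟦ j ⟧)
  ⟦⟧-weaklyDecidable i j with i ℤ.≟ j
  ... | yes refl = just refl
  ... | no _ = nothing

  open import Algebra.Solver.Ring ℤ-rawRing ℝ-almostCommutativeRing ℤ⟶ℝ ⟦⟧-weaklyDecidable public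
    using (solve; _:=_; _:+_; _:*_; :-_; _:-_)

module OrderedField (R : RealNumbers) where
  open import Relation.Binary.Bundles using (StrictTotalOrder)
  open import Relation.Binary.Structures using (IsStrictTotalOrder)
  open import Relation.Binary.Definitions using (tri<; tri≈; tri>)
  open import Relation.Unary using (Decidable)
  open import Data.List using (List; []; _∷_)
  open import Data.List.Membership.Propositional using (_∈_; _∉_)
  open import Data.List.Relation.Unary.Any using (here; there)
  open import Effect.Monad using (RawMonad)
  open RealNumbers R public
  open RingSolver R public using (commutativeRing; solve; _:=_; _:+_; _:*_; :-_; _:-_)
  open CommutativeRing commutativeRing public
    using (+-comm; +-identityˡ; +-identityʳ; *-assoc; *-comm; *-identityˡ; *-identityʳ;
           distribˡ; distribʳ; zeroˡ; zeroʳ; -‿inverseˡ; -‿inverseʳ; ring; semiring)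
  open import Algebra.Properties.Ring ring public using (-‿involutive; -‿distribˡ-*; -‿distribʳ-*; -0#≈0#)

  strictTotalOrder : StrictTotalOrder 0ℓ 0ℓ 0ℓ
  strictTotalOrder = record { isStrictTotalOrder = isStrictTotalOrder }

  open IsStrictTotalOrder isStrictTotalOrder public using (compare; _≟_; _<?_; irrefl; asym)
    renaming (trans to <-trans)
  open import Relation.Binary.Properties.StrictTotalOrder strictTotalOrder public
    using (_≤?_) renaming (refl to ≤-refl; trans to ≤-trans; antisym to ≤-antisym)

  infixl 6 _-_
  _-_ : ℝ → ℝ → ℝ
  x - y = x + - y

  <-irrefl : ∀ {x} → ¬ x < x
  <-irrefl = irrefl refl

  <-≤-trans : ∀ {x y z} → x < y → y ≤ z → x < z
  <-≤-trans x<y (inj₁ y<z) = <-trans x<y y<z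
  <-≤-trans x<y (inj₂ refl) = x<y

  ≤⇒≯ : ∀ {x y} → x ≤ y → ¬ y < x
  ≤⇒≯ (inj₁ x<y) y<x = asym x<y y<x
  ≤⇒≯ (inj₂ refl) x<x = <-irrefl x<x

  ≮⇒≥ : ∀ {x y} → ¬ x < y → y ≤ x
  ≮⇒≥ {x} {y} x≮y with compare x y
  ... | tri< x<y _ _ = contradiction x<y x≮y
  ... | tri≈ _ x≡y _ = inj₂ (sym x≡y)
  ... | tri> _ _ y<x = inj₁ y<x

  ≰⇒> : ∀ {x y} → ¬ x ≤ y → y < x
  ≰⇒> {x} {y} x≰y with compare x y
  ... | tri< x<y _ _ = contradiction (inj₁ x<y) x≰y
  ... | tri≈ _ x≡y _ = contradiction (inj₂ x≡y) x≰y
  ... | tri> _ _ y<x = y<x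

  ≤∧≢⇒< : ∀ {x y} → x ≤ y → x ≢ y → x < y
  ≤∧≢⇒< (inj₁ x<y) _ = x<y
  ≤∧≢⇒< (inj₂ x≡y) x≢y = contradiction x≡y x≢y

  +-monoˡ-< : ∀ {x y} z → x < y → z + x < z + y
  +-monoˡ-< {x} {y} z x<y = subst₂ _<_ (+-comm x z) (+-comm y z) (+-mono-< z x<y)

  +-monoʳ-≤ : ∀ {x y} z → x ≤ y → x + z ≤ y + z
  +-monoʳ-≤ z (inj₁ x<y) = inj₁ (+-mono-< z x<y)
  +-monoʳ-≤ z (inj₂ refl) = ≤-refl

  +-monoˡ-≤ : ∀ {x y} z → x ≤ y → z + x ≤ z + y
  +-monoˡ-≤ z (inj₁ x<y) = inj₁ (+-monoˡ-< z x<y)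
  +-monoˡ-≤ z (inj₂ refl) = ≤-refl

  +-mono-≤ : ∀ {a b c d} → a ≤ b → c ≤ d → a + c ≤ b + d
  +-mono-≤ {b = b} {c} a≤b c≤d = ≤-trans (+-monoʳ-≤ c a≤b) (+-monoˡ-≤ b c≤d)

  +-mono-<-≤ : ∀ {a b c d} → a < b → c ≤ d → a + c < b + d
  +-mono-<-≤ {b = b} {c} a<b c≤d = <-≤-trans (+-mono-< c a<b) (+-monoˡ-≤ b c≤d)

  +-mono-≤-< : ∀ {a b c d} → a ≤ b → c < d → a + c < b + d
  +-mono-≤-< {a} {b} {c} {d} a≤b c<d = subst₂ _<_ (+-comm c a) (+-comm d b) (+-mono-<-≤ c<d a≤b)

  x<x+y : ∀ x {y} → 0# < y → x < x + y
  x<x+y x {y} 0<y = subst (_< x + y) (+-identityʳ x) (+-monoˡ-< x 0<y)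

  x+y≤x : ∀ x {y} → y ≤ 0# → x + y ≤ x
  x+y≤x x {y} y≤0 = subst (x + y ≤_) (+-identityʳ x) (+-monoˡ-≤ x y≤0)

  x<y⇒0<y-x : ∀ {x y} → x < y → 0# < y - x
  x<y⇒0<y-x {x} {y} x<y = subst (_< y - x) (-‿inverseʳ x) (+-mono-< (- x) x<y)

  x≤y⇒0≤y-x : ∀ {x y} → x ≤ y → 0# ≤ y - x
  x≤y⇒0≤y-x (inj₁ x<y) = inj₁ (x<y⇒0<y-x x<y)
  x≤y⇒0≤y-x {x} (inj₂ refl) = inj₂ (sym (-‿inverseʳ x))

  x≤y⇒x-y≤0 : ∀ {x y} → x ≤ y → x - y ≤ 0#
  x≤y⇒x-y≤0 {x} {y} x≤y = subst (x - y ≤_) (-‿inverseʳ y) (+-monoʳ-≤ (- y) x≤y)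

  neg-antimono-< : ∀ {x y} → x < y → - y < - x
  neg-antimono-< {x} {y} x<y = subst₂ _<_
    (solve 2 (λ x y → x :+ (:- x :+ :- y) := :- y) refl x y)
    (solve 2 (λ x y → y :+ (:- x :+ :- y) := :- x) refl x y)
    (+-mono-< (- x + - y) x<y)

  x<0⇒0<-x : ∀ {x} → x < 0# → 0# < - x
  x<0⇒0<-x x<0 = subst (_< _) -0#≈0# (neg-antimono-< x<0)

  0<x⇒-x<0 : ∀ {x} → 0# < x → - x < 0#
  0<x⇒-x<0 0<x = subst (_ <_) -0#≈0# (neg-antimono-< 0<x)

  *-nonneg : ∀ {x y} → 0# ≤ x → 0# ≤ y → 0# ≤ x * y
  *-nonneg (inj₁ 0<x) (inj₁ 0<y) = inj₁ (*-pos 0<x 0<y)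
  *-nonneg {x} _ (inj₂ refl) = inj₂ (sym (zeroʳ x))
  *-nonneg {y = y} (inj₂ refl) _ = inj₂ (sym (zeroˡ y))

  neg*neg : ∀ {x y} → x < 0# → y < 0# → 0# < x * y
  neg*neg {x} {y} x<0 y<0 =
    subst (0# <_) (solve 2 (λ x y → (:- x) :* (:- y) := x :* y) refl x y) (*-pos (x<0⇒0<-x x<0) (x<0⇒0<-x y<0))

  *-monoˡ-≤ : ∀ {a x y} → 0# ≤ a → x ≤ y → a * x ≤ a * y
  *-monoˡ-≤ {a} {x} {y} 0≤a x≤y =
    subst₂ _≤_ (+-identityˡ (a * x)) (solve 3 (λ a x y → a :* (y :- x) :+ a :* x := a :* y) refl a x y)
      (+-monoʳ-≤ (a * x) (*-nonneg 0≤a (x≤y⇒0≤y-x x≤y)))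

  *-monoˡ-< : ∀ {a x y} → 0# < a → x < y → a * x < a * y
  *-monoˡ-< {a} {x} {y} 0<a x<y =
    subst₂ _<_ (+-identityˡ (a * x)) (solve 3 (λ a x y → a :* (y :- x) :+ a :* x := a :* y) refl a x y)
      (+-mono-< (a * x) (*-pos 0<a (x<y⇒0<y-x x<y)))

  *-monoʳ-≤ : ∀ {a x y} → 0# ≤ a → x ≤ y → x * a ≤ y * a
  *-monoʳ-≤ {a} {x} {y} 0≤a x≤y = subst₂ _≤_ (*-comm a x) (*-comm a y) (*-monoˡ-≤ 0≤a x≤y)

  nonneg*nonpos : ∀ {x y} → 0# ≤ x → y ≤ 0# → x * y ≤ 0#
  nonneg*nonpos {x} 0≤x y≤0 = subst (_ ≤_) (zeroʳ x) (*-monoˡ-≤ 0≤x y≤0)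

  0<1 : 0# < 1#
  0<1 with compare 0# 1#
  ... | tri< 0<1 _ _ = 0<1
  ... | tri≈ _ 0≡1 _ = contradiction 0≡1 0≢1
  ... | tri> _ _ 1<0 = contradiction (subst (0# <_) (*-identityˡ 1#) (neg*neg 1<0 1<0)) (asym 1<0)

  x*x≥0 : ∀ x → 0# ≤ x * x
  x*x≥0 x with compare x 0#
  ... | tri< x<0 _ _ = inj₁ (neg*neg x<0 x<0)
  ... | tri≈ _ refl _ = inj₂ (sym (zeroˡ 0#))
  ... | tri> _ _ 0<x = inj₁ (*-pos 0<x 0<x)

  x*x≡0⇒x≡0 : ∀ {x} → x * x ≡ 0# → x ≡ 0#
  x*x≡0⇒x≡0 {x} xx≡0 with compare x 0#
  ... | tri< x<0 _ _ = contradiction (subst (0# <_) xx≡0 (neg*neg x<0 x<0)) <-irrefl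
  ... | tri≈ _ x≡0 _ = x≡0
  ... | tri> _ _ 0<x = contradiction (subst (0# <_) xx≡0 (*-pos 0<x 0<x)) <-irrefl

  nonneg+nonneg≡0⇒≡0 : ∀ {x y} → 0# ≤ x → 0# ≤ y → x + y ≡ 0# → x ≡ 0#
  nonneg+nonneg≡0⇒≡0 (inj₂ 0≡x) _ _ = sym 0≡x
  nonneg+nonneg≡0⇒≡0 {x} {y} (inj₁ 0<x) 0≤y x+y≡0 =
    contradiction (subst₂ _<_ (+-identityʳ 0#) x+y≡0 (+-mono-<-≤ 0<x 0≤y)) <-irrefl

  0<x⇒x≢0 : ∀ {x} → 0# < x → x ≢ 0#
  0<x⇒x≢0 0<x x≡0 = <-irrefl (subst (0# <_) x≡0 0<x)

  -- A total inverse with recip 0# = 0#.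
  recip : ℝ → ℝ
  recip x with x ≟ 0#
  ... | yes _ = 0#
  ... | no x≢0 = proj₁ (inverse x x≢0)

  x*recip[x]≡1 : ∀ {x} → x ≢ 0# → x * recip x ≡ 1#
  x*recip[x]≡1 {x} x≢0 with x ≟ 0#
  ... | yes x≡0 = contradiction x≡0 x≢0
  ... | no x≢0 = proj₂ (inverse x x≢0)

  x*y≡0⇒x≡0 : ∀ {x y} → x * y ≡ 0# → y ≢ 0# → x ≡ 0#
  x*y≡0⇒x≡0 {x} {y} xy≡0 y≢0 = begin
    x                ≡⟨ sym (*-identityʳ x) ⟩
    x * 1#           ≡⟨ cong (x *_) (sym (x*recip[x]≡1 y≢0)) ⟩
    x * (y * recip y) ≡⟨ sym (*-assoc x y (recip y)) ⟩
    x * y * recip y  ≡⟨ cong (_* recip y) xy≡0 ⟩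
    0# * recip y     ≡⟨ zeroˡ (recip y) ⟩
    0#               ∎
    where open ≡-Reasoning

  a*recip[x]*x≡a : ∀ {a x} → x ≢ 0# → a * recip x * x ≡ a
  a*recip[x]*x≡a {a} {x} x≢0 =
    trans (*-assoc a _ x) (trans (cong (a *_) (trans (*-comm _ x) (x*recip[x]≡1 x≢0))) (*-identityʳ a))

  recip-pos : ∀ {x} → 0# < x → 0# < recip x
  recip-pos {x} 0<x = ≰⇒> λ recip≤0 →
    ≤⇒≯ (subst (_≤ 0#) (x*recip[x]≡1 (0<x⇒x≢0 0<x)) (nonneg*nonpos (inj₁ 0<x) recip≤0)) 0<1

  x-y≡0⇒x≡y : ∀ {x y} → x - y ≡ 0# → x ≡ y
  x-y≡0⇒x≡y {x} {y} x-y≡0 =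
    trans (solve 2 (λ x y → x := x :- y :+ y) refl x y) (trans (cong (_+ y) x-y≡0) (+-identityˡ y))

  half : ℝ
  half = recip (1# + 1#)

  0<2 : 0# < 1# + 1#
  0<2 = <-trans 0<1 (subst (_< 1# + 1#) (+-identityʳ 1#) (+-monoˡ-< 1# 0<1))

  half*[x+x]≡x : ∀ x → half * (x + x) ≡ x
  half*[x+x]≡x x = begin
    half * (x + x)          ≡⟨ cong (half *_) (sym (trans (distribʳ x 1# 1#)
                                                            (cong₂ _+_ (*-identityˡ x) (*-identityˡ x)))) ⟩
    half * ((1# + 1#) * x)  ≡⟨ sym (*-assoc half _ x) ⟩
    half * (1# + 1#) * x    ≡⟨ cong (_* x) (trans (*-comm half _) (x*recip[x]≡1 (0<x⇒x≢0 0<2))) ⟩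
    1# * x                  ≡⟨ *-identityˡ x ⟩
    x                       ∎
    where open ≡-Reasoning

  average-≤ : ∀ {a b c} → a ≤ c → b ≤ c → half * (a + b) ≤ c
  average-≤ {c = c} a≤c b≤c =
    subst (_ ≤_) (half*[x+x]≡x c) (*-monoˡ-≤ (inj₁ (recip-pos 0<2)) (+-mono-≤ a≤c b≤c))

  average-≡⇒≡ : ∀ {a b c} → a ≤ c → b ≤ c → half * (a + b) ≡ c → a ≡ c
  average-≡⇒≡ (inj₂ a≡c) _ _ = a≡c
  average-≡⇒≡ {c = c} (inj₁ a<c) b≤c avg≡c = contradiction
    (subst₂ _<_ avg≡c (half*[x+x]≡x c) (*-monoˡ-< (recip-pos 0<2) (+-mono-<-≤ a<c b≤c))) <-irrefl

  argmin-on : ∀ {n} (P : Fin n → Set) → Decidable P → (f : Fin n → ℝ) →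
              (∀ i → ¬ P i) ⊎ Σ (Fin n) (λ i₀ → P i₀ × (∀ i → P i → f i₀ ≤ f i))
  argmin-on {zero} P P? f = inj₁ (λ ())
  argmin-on {suc n} P P? f with argmin-on (P ∘ suc) (P? ∘ suc) (f ∘ suc) | P? zero
  ... | inj₁ none | no ¬P₀ = inj₁ λ { zero → ¬P₀ ; (suc i) → none i }
  ... | inj₁ none | yes P₀ =
    inj₂ (zero , P₀ , λ { zero _ → ≤-refl ; (suc i) Pi → contradiction Pi (none i) })
  ... | inj₂ (i₁ , P₁ , min₁) | no ¬P₀ =
    inj₂ (suc i₁ , P₁ , λ { zero P₀ → contradiction P₀ ¬P₀ ; (suc i) Pi → min₁ i Pi })
  ... | inj₂ (i₁ , P₁ , min₁) | yes P₀ with f zero ≤? f (suc i₁)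
  ...   | yes f₀≤f₁ = inj₂ (zero , P₀ , λ { zero _ → ≤-refl ; (suc i) Pi → ≤-trans f₀≤f₁ (min₁ i Pi) })
  ...   | no f₀≰f₁ = inj₂ (suc i₁ , P₁ , λ { zero _ → inj₁ (≰⇒> f₀≰f₁) ; (suc i) Pi → min₁ i Pi })

  open RawMonad (¬¬-Monad {0ℓ}) public using (return; _>>=_)

  -- Which tags occur is not decidable, so the maximum over finitely many tags is only
  -- obtained up to double negation.
  module _ {X T : Set} (V : X → Set) (value : X → ℝ) (tag : X → T)
           (tag-determines-value : ∀ {x y} → V x → V y → tag x ≡ tag y → value x ≡ value y) where

    private
      MaximumOn : List T → Set
      MaximumOn L = (Σ X λ x → V x × tag x ∈ L × ∀ y → V y → tag y ∈ L → value y ≤ value x)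
                  ⊎ (∀ y → V y → tag y ∉ L)

      maximumOn : ∀ L → ¬ ¬ MaximumOn L
      maximumOn [] = return (inj₂ λ _ _ ())
      maximumOn (t ∷ L) = do
        maxL ← maximumOn L
        tagged? ← ¬¬-excluded-middle
        return (extend maxL tagged?)
        where
        extend : MaximumOn L → Dec (Σ X λ y → V y × tag y ≡ t) → MaximumOn (t ∷ L)
        extend (inj₂ none) (no untagged) = inj₂ λ
          { y Vy (here e) → untagged (y , Vy , e) ; y Vy (there y∈L) → none y Vy y∈L }
        extend (inj₂ none) (yes (y₀ , Vy₀ , e₀)) = inj₁ (y₀ , Vy₀ , here e₀ , λ
          { y Vy (here e) → inj₂ (tag-determines-value Vy Vy₀ (trans e (sym e₀)))
          ; y Vy (there y∈L) → contradiction y∈L (none y Vy) })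
        extend (inj₁ (x , Vx , x∈L , max)) (no untagged) = inj₁ (x , Vx , there x∈L , λ
          { y Vy (here e) → contradiction (y , Vy , e) untagged ; y Vy (there y∈L) → max y Vy y∈L })
        extend (inj₁ (x , Vx , x∈L , max)) (yes (y₀ , Vy₀ , e₀)) with value y₀ ≤? value x
        ... | yes y₀≤x = inj₁ (x , Vx , there x∈L , λ
          { y Vy (here e) → ≤-trans (inj₂ (tag-determines-value Vy Vy₀ (trans e (sym e₀)))) y₀≤x
          ; y Vy (there y∈L) → max y Vy y∈L })
        ... | no y₀≰x = inj₁ (y₀ , Vy₀ , here e₀ , λ
          { y Vy (here e) → inj₂ (tag-determines-value Vy Vy₀ (trans e (sym e₀)))
          ; y Vy (there y∈L) → ≤-trans (max y Vy y∈L) (inj₁ (≰⇒> y₀≰x)) })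

    ¬¬-maximum : (L : List T) → (∀ x → tag x ∈ L) → Σ X V →
                 ¬ ¬ (Σ X λ x → V x × ∀ y → V y → value y ≤ value x)
    ¬¬-maximum L complete (x₀ , Vx₀) = do
      max ← maximumOn L
      case max of λ
        { (inj₁ (x , Vx , _ , max)) → return (x , Vx , λ y Vy → max y Vy (complete y))
        ; (inj₂ none) → λ _ → none x₀ Vx₀ (complete x₀) }

module Euclidean (R : RealNumbers) where
  open import Data.Vec.Functional as Vector using (_∷_; removeAt; insertAt)
  import Data.Vec.Functional.Properties as Vector
  open import Data.Fin.Properties using (any?)
  open OrderedField R public
  open UnitLP R public
  open import Algebra.Properties.Semiring.Sum semiring
    using (sum; ∑-distrib-+; ∑-comm; sum-remove; *-distribʳ-sum)

  private variable
    d k : ℕ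

  Σ≡sum : (f : Fin k → ℝ) → Σ[ f ] ≡ sum f
  Σ≡sum {zero} f = refl
  Σ≡sum {suc k} f = cong (f zero +_) (Σ≡sum (f ∘ suc))

  Σ-cong : {f g : Fin k → ℝ} → (∀ i → f i ≡ g i) → Σ[ f ] ≡ Σ[ g ]
  Σ-cong {zero} f≗g = refl
  Σ-cong {suc k} f≗g = cong₂ _+_ (f≗g zero) (Σ-cong (f≗g ∘ suc))

  Σ-zero : {f : Fin k → ℝ} → (∀ i → f i ≡ 0#) → Σ[ f ] ≡ 0#
  Σ-zero {zero} f≗0 = refl
  Σ-zero {suc k} f≗0 = trans (cong₂ _+_ (f≗0 zero) (Σ-zero (f≗0 ∘ suc))) (+-identityʳ 0#)

  Σ-+ : (f g : Fin k → ℝ) → Σ[ (λ i → f i + g i) ] ≡ Σ[ f ] + Σ[ g ]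
  Σ-+ f g = trans (Σ≡sum (λ i → f i + g i)) (trans (∑-distrib-+ f g) (sym (cong₂ _+_ (Σ≡sum f) (Σ≡sum g))))

  Σ-neg : (f : Fin k → ℝ) → Σ[ (λ i → - f i) ] ≡ - Σ[ f ]
  Σ-neg {zero} f = sym -0#≈0#
  Σ-neg {suc k} f = trans (cong (- f zero +_) (Σ-neg (f ∘ suc)))
    (solve 2 (λ a b → :- a :+ :- b := :- (a :+ b)) refl (f zero) Σ[ f ∘ suc ])

  Σ-- : (f g : Fin k → ℝ) → Σ[ (λ i → f i - g i) ] ≡ Σ[ f ] - Σ[ g ]
  Σ-- f g = trans (Σ-+ f (λ i → - g i)) (cong (Σ[ f ] +_) (Σ-neg g))

  Σ-*ʳ : (f : Fin k → ℝ) (x : ℝ) → Σ[ (λ i → f i * x) ] ≡ Σ[ f ] * x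
  Σ-*ʳ f x = trans (Σ≡sum (λ i → f i * x)) (sym (trans (cong (_* x) (Σ≡sum f)) (*-distribʳ-sum x f)))

  Σ-comm : ∀ {l} (f : Fin k → Fin l → ℝ) → Σ[ (λ i → Σ[ f i ]) ] ≡ Σ[ (λ j → Σ[ (λ i → f i j) ]) ]
  Σ-comm f = begin
    Σ[ (λ i → Σ[ f i ]) ]            ≡⟨ trans (Σ-cong (λ i → Σ≡sum (f i))) (Σ≡sum (λ i → sum (f i))) ⟩
    sum (λ i → sum (f i))            ≡⟨ ∑-comm f ⟩
    sum (λ j → sum (λ i → f i j))    ≡⟨ sym (trans (Σ-cong (λ j → Σ≡sum (λ i → f i j)))
                                                   (Σ≡sum (λ j → sum (λ i → f i j)))) ⟩
    Σ[ (λ j → Σ[ (λ i → f i j) ]) ]  ∎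
    where open ≡-Reasoning

  Σ-remove : (f : Fin (suc k) → ℝ) (j : Fin (suc k)) → Σ[ f ] ≡ f j + Σ[ removeAt f j ]
  Σ-remove f j = trans (Σ≡sum f) (trans (sum-remove f) (cong (f j +_) (sym (Σ≡sum (removeAt f j)))))

  Σ-mono-≤ : {f g : Fin k → ℝ} → (∀ i → f i ≤ g i) → Σ[ f ] ≤ Σ[ g ]
  Σ-mono-≤ {zero} f≤g = ≤-refl
  Σ-mono-≤ {suc k} f≤g = +-mono-≤ (f≤g zero) (Σ-mono-≤ (f≤g ∘ suc))

  Σ-nonneg : {f : Fin k → ℝ} → (∀ i → 0# ≤ f i) → 0# ≤ Σ[ f ]
  Σ-nonneg {k} {f} 0≤f = subst (_≤ Σ[ f ]) (Σ-zero {k} {λ _ → 0#} (λ _ → refl)) (Σ-mono-≤ 0≤f)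

  Σ-nonpos : {f : Fin k → ℝ} → (∀ i → f i ≤ 0#) → Σ[ f ] ≤ 0#
  Σ-nonpos {k} {f} f≤0 = subst (Σ[ f ] ≤_) (Σ-zero {k} {λ _ → 0#} (λ _ → refl)) (Σ-mono-≤ f≤0)

  Σ-nonneg-≡0 : {f : Fin k → ℝ} → (∀ i → 0# ≤ f i) → Σ[ f ] ≡ 0# → ∀ i → f i ≡ 0#
  Σ-nonneg-≡0 {suc k} 0≤f Σ≡0 zero = nonneg+nonneg≡0⇒≡0 (0≤f zero) (Σ-nonneg (0≤f ∘ suc)) Σ≡0
  Σ-nonneg-≡0 {suc k} 0≤f Σ≡0 (suc i) = Σ-nonneg-≡0 (0≤f ∘ suc)
    (nonneg+nonneg≡0⇒≡0 (Σ-nonneg (0≤f ∘ suc)) (0≤f zero) (trans (+-comm _ _) Σ≡0)) i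

  infixl 6 _+ᵥ_ _-ᵥ_
  infixr 7 _∙ᵥ_

  _+ᵥ_ _-ᵥ_ : Vec d → Vec d → Vec d
  (u +ᵥ v) t = u t + v t
  (u -ᵥ v) t = u t - v t

  _∙ᵥ_ : ℝ → Vec d → Vec d
  (c ∙ᵥ u) t = c * u t

  -ᵥ_ : Vec d → Vec d
  (-ᵥ u) t = - u t

  lc : (Fin k → ℝ) → (Fin k → Vec d) → Vec d
  lc c w t = Σ[ (λ s → c s * w s t) ]

  ⟨⟩-comm : (u v : Vec d) → ⟨ u , v ⟩ ≡ ⟨ v , u ⟩
  ⟨⟩-comm u v = Σ-cong (λ t → *-comm (u t) (v t))

  ⟨⟩-congˡ : {u u′ : Vec d} (v : Vec d) → u ≗ u′ → ⟨ u , v ⟩ ≡ ⟨ u′ , v ⟩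
  ⟨⟩-congˡ v u≗u′ = Σ-cong (λ t → cong (_* v t) (u≗u′ t))

  ⟨⟩-congʳ : (u : Vec d) {v v′ : Vec d} → v ≗ v′ → ⟨ u , v ⟩ ≡ ⟨ u , v′ ⟩
  ⟨⟩-congʳ u v≗v′ = Σ-cong (λ t → cong (u t *_) (v≗v′ t))

  ⟨⟩-zeroˡ : (u : Vec d) → ⟨ zeroV , u ⟩ ≡ 0#
  ⟨⟩-zeroˡ u = Σ-zero (λ t → zeroˡ (u t))

  ⟨⟩-zeroʳ : (u : Vec d) → ⟨ u , zeroV ⟩ ≡ 0#
  ⟨⟩-zeroʳ u = trans (⟨⟩-comm u zeroV) (⟨⟩-zeroˡ u)

  ⟨⟩-+ʳ : (u v w : Vec d) → ⟨ u , v +ᵥ w ⟩ ≡ ⟨ u , v ⟩ + ⟨ u , w ⟩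
  ⟨⟩-+ʳ u v w = trans (Σ-cong (λ t → distribˡ (u t) (v t) (w t))) (Σ-+ (λ t → u t * v t) (λ t → u t * w t))

  ⟨⟩--ʳ : (u v w : Vec d) → ⟨ u , v -ᵥ w ⟩ ≡ ⟨ u , v ⟩ - ⟨ u , w ⟩
  ⟨⟩--ʳ u v w = trans
    (Σ-cong (λ t → solve 3 (λ a b c → a :* (b :- c) := a :* b :- a :* c) refl (u t) (v t) (w t)))
    (Σ-- (λ t → u t * v t) (λ t → u t * w t))

  ⟨⟩-∙ʳ : (u : Vec d) (c : ℝ) (v : Vec d) → ⟨ u , c ∙ᵥ v ⟩ ≡ c * ⟨ u , v ⟩
  ⟨⟩-∙ʳ u c v = trans (Σ-cong (λ t → solve 3 (λ a c b → a :* (c :* b) := (a :* b) :* c) refl (u t) c (v t)))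
    (trans (Σ-*ʳ (λ t → u t * v t) c) (*-comm _ c))

  ⟨⟩-negʳ : (u v : Vec d) → ⟨ u , -ᵥ v ⟩ ≡ - ⟨ u , v ⟩
  ⟨⟩-negʳ u v = trans (Σ-cong (λ t → sym (-‿distribʳ-* (u t) (v t)))) (Σ-neg (λ t → u t * v t))

  ⟨lc,⟩ : (c : Fin k → ℝ) (w : Fin k → Vec d) (y : Vec d) →
          ⟨ lc c w , y ⟩ ≡ Σ[ (λ s → c s * ⟨ w s , y ⟩) ]
  ⟨lc,⟩ c w y = begin
    Σ[ (λ t → Σ[ (λ s → c s * w s t) ] * y t) ]   ≡⟨ Σ-cong (λ t → sym (Σ-*ʳ (λ s → c s * w s t) (y t))) ⟩
    Σ[ (λ t → Σ[ (λ s → c s * w s t * y t) ]) ]   ≡⟨ Σ-comm (λ t s → c s * w s t * y t) ⟩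
    Σ[ (λ s → Σ[ (λ t → c s * w s t * y t) ]) ]   ≡⟨ Σ-cong (λ s → trans (Σ-cong (λ t → reorder (c s) (w s t) (y t)))
                                                                        (trans (Σ-*ʳ (λ t → w s t * y t) (c s))
                                                                               (*-comm _ (c s)))) ⟩
    Σ[ (λ s → c s * ⟨ w s , y ⟩) ]                ∎
    where
    open ≡-Reasoning
    reorder : ∀ c w y → c * w * y ≡ w * y * c
    reorder = solve 3 (λ c w y → c :* w :* y := w :* y :* c) refl

  ⟨u,u⟩≥0 : (u : Vec d) → 0# ≤ ⟨ u , u ⟩
  ⟨u,u⟩≥0 u = Σ-nonneg (λ t → x*x≥0 (u t))

  ⟨u,u⟩≡0⇒u≗0 : (u : Vec d) → ⟨ u , u ⟩ ≡ 0# → u ≗ zeroV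
  ⟨u,u⟩≡0⇒u≗0 u uu≡0 t = x*x≡0⇒x≡0 (Σ-nonneg-≡0 (λ t → x*x≥0 (u t)) uu≡0 t)

  lc-shift : (c : Fin k → ℝ) (u : Fin k → Vec d) (β : Fin k → ℝ) (y : Vec d) →
             lc c (λ s → u s -ᵥ β s ∙ᵥ y) ≗ lc c u -ᵥ Σ[ (λ s → c s * β s) ] ∙ᵥ y
  lc-shift c u β y t = trans (Σ-cong (λ s → distribute (c s) (u s t) (β s) (y t)))
    (trans (Σ-- (λ s → c s * u s t) (λ s → c s * β s * y t)) (cong (_-_ (lc c u t)) (Σ-*ʳ (λ s → c s * β s) (y t))))
    where
    distribute : ∀ c u b y → c * (u - b * y) ≡ c * u - c * b * y
    distribute = solve 4 (λ c u b y → c :* (u :- b :* y) := c :* u :- c :* b :* y) refl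

  lc-neg : (c : Fin k → ℝ) (w : Fin k → Vec d) → lc (λ s → - c s) w ≗ -ᵥ lc c w
  lc-neg c w t = trans (Σ-cong (λ s → sym (-‿distribˡ-* (c s) (w s t)))) (Σ-neg (λ s → c s * w s t))

  lc-insertAt : (c : Fin k → ℝ) (w : Fin (suc k) → Vec d) (j : Fin (suc k)) (a : ℝ) →
                lc (insertAt c j a) w ≗ a ∙ᵥ w j +ᵥ lc c (removeAt w j)
  lc-insertAt c w j a t = trans (Σ-remove (λ s → insertAt c j a s * w s t) j)
    (cong₂ _+_ (cong (_* w j t) (Vector.insertAt-lookup c j a))
               (Σ-cong (λ i → cong (_* w (punchIn j i) t) (Vector.insertAt-punchIn c j a i))))

  InSpan : Vec d → (Fin k → Vec d) → Set
  InSpan v w = Σ (Fin _ → ℝ) λ c → v ≗ lc c w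

  InCone : Vec d → (Fin k → Vec d) → Set
  InCone v w = Σ (Fin _ → ℝ) λ c → (∀ s → 0# ≤ c s) × v ≗ lc c w

  Separating : Vec d → (Fin k → Vec d) → Set
  Separating v w = Σ (Vec _) λ r → (∀ s → ⟨ w s , r ⟩ ≡ 0#) × 0# < ⟨ v , r ⟩

  LinearlyIndependent : (Fin k → Vec d) → Set
  LinearlyIndependent w = ∀ c → lc c w ≗ zeroV → ∀ s → c s ≡ 0#

  -- One Gram–Schmidt step: project orthogonally to w zero and recurse on the other vectors.
  -- When w zero is the zero vector, recip makes coeff vanish and project the identity.
  module Projection (w : Fin (suc k) → Vec d) where
    coeff : Vec d → ℝ
    coeff u = ⟨ u , w zero ⟩ * recip ⟨ w zero , w zero ⟩

    project : Vec d → Vec d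
    project u = u -ᵥ coeff u ∙ᵥ w zero

    ⟨,project⟩ : (u v : Vec d) → ⟨ u , project v ⟩ ≡ ⟨ u , v ⟩ - coeff v * ⟨ u , w zero ⟩
    ⟨,project⟩ u v = trans (⟨⟩--ʳ u v _) (cong (_-_ (⟨ u , v ⟩)) (⟨⟩-∙ʳ u (coeff v) (w zero)))

    project-selfAdjoint : (u v : Vec d) → ⟨ u , project v ⟩ ≡ ⟨ project u , v ⟩
    project-selfAdjoint u v = begin
      ⟨ u , project v ⟩                                    ≡⟨ ⟨,project⟩ u v ⟩
      ⟨ u , v ⟩ - ⟨ v , w zero ⟩ * ρ * ⟨ u , w zero ⟩      ≡⟨ cong₂ _-_ (⟨⟩-comm u v) (swap _ ρ _) ⟩
      ⟨ v , u ⟩ - ⟨ u , w zero ⟩ * ρ * ⟨ v , w zero ⟩      ≡⟨ sym (⟨,project⟩ v u) ⟩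
      ⟨ v , project u ⟩                                    ≡⟨ ⟨⟩-comm v (project u) ⟩
      ⟨ project u , v ⟩                                    ∎
      where
      open ≡-Reasoning
      ρ = recip ⟨ w zero , w zero ⟩
      swap : ∀ a ρ b → a * ρ * b ≡ b * ρ * a
      swap = solve 3 (λ a ρ b → a :* ρ :* b := b :* ρ :* a) refl

    project-w₀ : project (w zero) ≗ zeroV
    project-w₀ t = by-cases (⟨ w zero , w zero ⟩ ≟ 0#)
      where
      by-cases : Dec (⟨ w zero , w zero ⟩ ≡ 0#) → project (w zero) t ≡ 0#
      by-cases (yes ww≡0) = trans (cong (λ x → x - coeff (w zero) * x) (⟨u,u⟩≡0⇒u≗0 (w zero) ww≡0 t))
                              (trans (cong (_-_ 0#) (zeroʳ _)) (-‿inverseʳ 0#))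
      by-cases (no ww≢0) = trans (cong (λ a → w zero t - a * w zero t) (x*recip[x]≡1 ww≢0))
                             (trans (cong (_-_ (w zero t)) (*-identityˡ _)) (-‿inverseʳ _))

    span-lift : ∀ {v} → InSpan (project v) (project ∘ w ∘ suc) → InSpan v w
    span-lift {v} (c , h) = (coeff v - S) ∷ c , λ t → begin
      v t                                                     ≡⟨ split (coeff v * w zero t) (v t) ⟩
      coeff v * w zero t + project v t                        ≡⟨ cong (coeff v * w zero t +_) (trans (h t)
                                                                   (lc-shift c (w ∘ suc) (coeff ∘ w ∘ suc) (w zero) t)) ⟩
      coeff v * w zero t + (lc c (w ∘ suc) t - S * w zero t)  ≡⟨ collect (coeff v) (w zero t) (lc c (w ∘ suc) t) S ⟩
      (coeff v - S) * w zero t + lc c (w ∘ suc) t            ∎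
      where
      open ≡-Reasoning
      S = Σ[ (λ s → c s * coeff (w (suc s))) ]
      split : ∀ a x → x ≡ a + (x - a)
      split = solve 2 (λ a x → x := a :+ (x :- a)) refl
      collect : ∀ a x l s → a * x + (l - s * x) ≡ (a - s) * x + l
      collect = solve 4 (λ a x l s → a :* x :+ (l :- s :* x) := (a :- s) :* x :+ l) refl

    separating-lift : ∀ {v} → Separating (project v) (project ∘ w ∘ suc) → Separating v w
    separating-lift {v} (r , r⊥ , 0<vr) = project r , project-r⊥ , subst (0# <_) (sym (project-selfAdjoint v r)) 0<vr
      where
      project-r⊥ : ∀ s → ⟨ w s , project r ⟩ ≡ 0#
      project-r⊥ zero = trans (project-selfAdjoint (w zero) r) (trans (⟨⟩-congˡ r project-w₀) (⟨⟩-zeroˡ r))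
      project-r⊥ (suc s) = trans (project-selfAdjoint (w (suc s)) r) (r⊥ s)

  span-or-separating : (v : Vec d) (w : Fin k → Vec d) → InSpan v w ⊎ Separating v w
  span-or-separating {k = zero} v w with ⟨ v , v ⟩ ≟ 0#
  ... | yes vv≡0 = inj₁ ((λ ()) , ⟨u,u⟩≡0⇒u≗0 v vv≡0)
  ... | no vv≢0 = inj₂ (v , (λ ()) , ≤∧≢⇒< (⟨u,u⟩≥0 v) (vv≢0 ∘ sym))
  span-or-separating {k = suc k} v w =
    Sum.map span-lift separating-lift (span-or-separating (project v) (project ∘ w ∘ suc))
    where open Projection w

  -- Gaussian elimination of the first coordinate with pivot u j.  IsPivot holds for every j
  -- when the whole first column vanishes.
  module Elimination {n} (u : Fin (suc n) → Vec (suc d)) (j : Fin (suc n)) where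
    multiplier : Fin n → ℝ
    multiplier i = u (punchIn j i) zero * recip (u j zero)

    eliminate : Fin n → Vec d
    eliminate i = Vector.tail (u (punchIn j i)) -ᵥ multiplier i ∙ᵥ Vector.tail (u j)

    IsPivot : Set
    IsPivot = ∀ i → multiplier i * u j zero ≡ u (punchIn j i) zero

    eliminate-independent : IsPivot → LinearlyIndependent u → LinearlyIndependent eliminate
    eliminate-independent pivot independent c elim≗0 i = begin
      c i                                  ≡⟨ sym (Vector.insertAt-punchIn c j E i) ⟩
      insertAt c j E (punchIn j i)         ≡⟨ independent (insertAt c j E) combination≗0 (punchIn j i) ⟩
      0#                                   ∎
      where
      open ≡-Reasoning
      S = Σ[ (λ i → c i * multiplier i) ]
      E = - S
      combination≗0 : lc (insertAt c j E) u ≗ zeroV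
      combination≗0 zero = begin
        lc (insertAt c j E) u zero                                ≡⟨ lc-insertAt c u j E zero ⟩
        E * u j zero + Σ[ (λ i → c i * u (punchIn j i) zero) ]   ≡⟨ cong (E * u j zero +_)
                                                                      (Σ-cong (λ i → cong (c i *_) (sym (pivot i)))) ⟩
        E * u j zero + Σ[ (λ i → c i * (multiplier i * u j zero)) ]
                                                                  ≡⟨ cong (E * u j zero +_) (trans
                                                                      (Σ-cong (λ i → sym (*-assoc (c i) _ _)))
                                                                      (Σ-*ʳ (λ i → c i * multiplier i) (u j zero))) ⟩
        - S * u j zero + S * u j zero                             ≡⟨ cong (_+ S * u j zero) (sym (-‿distribˡ-* S _)) ⟩
        - (S * u j zero) + S * u j zero                           ≡⟨ -‿inverseˡ _ ⟩
        0#                                                        ∎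
      combination≗0 (suc t) = begin
        lc (insertAt c j E) u (suc t)                             ≡⟨ lc-insertAt c u j E (suc t) ⟩
        E * u j (suc t) + lc c (Vector.tail ∘ u ∘ punchIn j) t    ≡⟨ reorder S (u j (suc t)) _ ⟩
        lc c (Vector.tail ∘ u ∘ punchIn j) t - S * u j (suc t)    ≡⟨ sym (lc-shift c (Vector.tail ∘ u ∘ punchIn j)
                                                                           multiplier (Vector.tail (u j)) t) ⟩
        lc c eliminate t                                          ≡⟨ elim≗0 t ⟩
        0#                                                        ∎
        where
        reorder : ∀ s x l → - s * x + l ≡ l - s * x
        reorder = solve 3 (λ s x l → :- s :* x :+ l := l :- s :* x) refl

  pivot : ∀ {n} (u : Fin (suc n) → Vec (suc d)) → Σ (Fin (suc n)) (Elimination.IsPivot u)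
  pivot u with any? (λ j → ¬? (u j zero ≟ 0#))
  ... | yes (j , u[j]≢0) = j , λ i → a*recip[x]*x≡a u[j]≢0
  ... | no no-nonzero = zero , λ i →
    trans (cong (Elimination.multiplier u zero i *_) (column-zero zero)) (trans (zeroʳ _) (sym (column-zero (suc i))))
    where
    column-zero : ∀ k → u k zero ≡ 0#
    column-zero k = decidable-stable (u k zero ≟ 0#) (λ u[k]≢0 → no-nonzero (k , u[k]≢0))

  d+1-vectors-dependent : (u : Fin (suc d) → Vec d) → ¬ LinearlyIndependent u
  d+1-vectors-dependent {zero} u independent = 0≢1 (sym (independent (λ _ → 1#) (λ ()) zero))
  d+1-vectors-dependent {suc d} u independent with pivot u
  ... | j , isPivot = d+1-vectors-dependent (eliminate u j) (eliminate-independent u j isPivot independent)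
    where open Elimination

  independent-∷ : (u : Vec d) (w : Fin k → Vec d) → LinearlyIndependent w →
                  (∀ s → ⟨ w s , u ⟩ ≡ 0#) → ⟨ u , u ⟩ ≢ 0# → LinearlyIndependent (u ∷ w)
  independent-∷ u w independent u⊥w uu≢0 c lc≗0 = coefficient≡0
    where
    open ≡-Reasoning
    c₀*uu≡0 : c zero * ⟨ u , u ⟩ ≡ 0#
    c₀*uu≡0 = begin
      c zero * ⟨ u , u ⟩                                   ≡⟨ sym (+-identityʳ _) ⟩
      c zero * ⟨ u , u ⟩ + 0#                              ≡⟨ cong (c zero * ⟨ u , u ⟩ +_) (sym (Σ-zero
                                                                (λ s → trans (cong (c (suc s) *_) (u⊥w s)) (zeroʳ _)))) ⟩
      Σ[ (λ s → c s * ⟨ (u ∷ w) s , u ⟩) ]                ≡⟨ sym (⟨lc,⟩ c (u ∷ w) u) ⟩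
      ⟨ lc c (u ∷ w) , u ⟩                                 ≡⟨ ⟨⟩-congˡ u lc≗0 ⟩
      ⟨ zeroV , u ⟩                                        ≡⟨ ⟨⟩-zeroˡ u ⟩
      0#                                                   ∎
    c₀≡0 : c zero ≡ 0#
    c₀≡0 = x*y≡0⇒x≡0 c₀*uu≡0 uu≢0
    tail≗0 : lc (c ∘ suc) w ≗ zeroV
    tail≗0 t = trans (sym (+-identityˡ _))
      (trans (cong (_+ lc (c ∘ suc) w t) (sym (trans (cong (_* u t) c₀≡0) (zeroˡ (u t))))) (lc≗0 t))
    coefficient≡0 : ∀ s → c s ≡ 0#
    coefficient≡0 zero = c₀≡0
    coefficient≡0 (suc s) = independent (c ∘ suc) tail≗0 s

  orthogonal-to-independent⇒≗0 : {u : Vec d} (w : Fin d → Vec d) → LinearlyIndependent w →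
                                 (∀ s → ⟨ w s , u ⟩ ≡ 0#) → u ≗ zeroV
  orthogonal-to-independent⇒≗0 {u = u} w independent u⊥w with ⟨ u , u ⟩ ≟ 0#
  ... | yes uu≡0 = ⟨u,u⟩≡0⇒u≗0 u uu≡0
  ... | no uu≢0 = contradiction (independent-∷ u w independent u⊥w uu≢0) (d+1-vectors-dependent (u ∷ w))

  independent⇒∉span : (w : Fin (suc k) → Vec d) → LinearlyIndependent w → ∀ j → ¬ InSpan (w j) (removeAt w j)
  independent⇒∉span w independent j (c , w[j]≗lc) = 0≢1 (sym (trans (sym (Vector.insertAt-lookup _ j 1#)) e[j]≡0))
    where
    e = insertAt (λ i → - c i) j 1#
    e[j]≡0 : e j ≡ 0#
    e[j]≡0 = independent e (λ t → begin
      lc e w t                                       ≡⟨ lc-insertAt (λ i → - c i) w j 1# t ⟩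
      1# * w j t + lc (λ i → - c i) (removeAt w j) t ≡⟨ cong₂ _+_ (*-identityˡ _) (lc-neg c (removeAt w j) t) ⟩
      w j t - lc c (removeAt w j) t                  ≡⟨ cong (_- lc c (removeAt w j) t) (w[j]≗lc t) ⟩
      lc c (removeAt w j) t - lc c (removeAt w j) t  ≡⟨ -‿inverseʳ _ ⟩
      0#                                             ∎) j
      where open ≡-Reasoning

  NoImprovingDirection : Vec d → (Fin k → Vec d) → Set
  NoImprovingDirection z w = ∀ r → (∀ s → ⟨ w s , r ⟩ ≤ 0#) → ¬ 0# < ⟨ z , r ⟩

  noImproving⇒inSpan : {z : Vec d} (w : Fin k → Vec d) → NoImprovingDirection z w → InSpan z w
  noImproving⇒inSpan {z = z} w noImproving with span-or-separating z w
  ... | inj₁ inSpan = inSpan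
  ... | inj₂ (r , r⊥ , 0<zr) = contradiction 0<zr (noImproving r (λ s → inj₂ (r⊥ s)))

  -- If c j < 0, a direction orthogonal to the other w s and negative on w j improves z.
  noImproving⇒nonneg : {z : Vec d} (w : Fin k → Vec d) → LinearlyIndependent w → NoImprovingDirection z w →
                       ∀ c → z ≗ lc c w → ∀ j → 0# ≤ c j
  noImproving⇒nonneg {k = suc k} {z} w independent noImproving c z≗lc j with 0# ≤? c j
  ... | yes 0≤c[j] = 0≤c[j]
  ... | no 0≰c[j] with span-or-separating (w j) (removeAt w j)
  ...   | inj₁ inSpan = contradiction inSpan (independent⇒∉span w independent j)
  ...   | inj₂ (r , r⊥ , 0<w[j]r) = contradiction improving (noImproving (-ᵥ r) nonpositive)
    where
    ⟨w[j],-r⟩<0 : ⟨ w j , -ᵥ r ⟩ < 0#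
    ⟨w[j],-r⟩<0 = subst (_< 0#) (sym (⟨⟩-negʳ (w j) r)) (0<x⇒-x<0 0<w[j]r)
    -r⊥ : ∀ i → ⟨ w (punchIn j i) , -ᵥ r ⟩ ≡ 0#
    -r⊥ i = trans (⟨⟩-negʳ _ r) (trans (cong -_ (r⊥ i)) -0#≈0#)
    nonpositive : ∀ s → ⟨ w s , -ᵥ r ⟩ ≤ 0#
    nonpositive s with j Fin.≟ s
    ... | yes refl = inj₁ ⟨w[j],-r⟩<0
    ... | no j≢s =
      inj₂ (subst (λ s → ⟨ w s , -ᵥ r ⟩ ≡ 0#) (Fin.punchIn-punchOut j≢s) (-r⊥ (punchOut j≢s)))
    improving : 0# < ⟨ z , -ᵥ r ⟩
    improving = subst (0# <_) (sym (begin
      ⟨ z , -ᵥ r ⟩                           ≡⟨ ⟨⟩-congˡ (-ᵥ r) z≗lc ⟩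
      ⟨ lc c w , -ᵥ r ⟩                      ≡⟨ ⟨lc,⟩ c w (-ᵥ r) ⟩
      Σ[ (λ s → c s * ⟨ w s , -ᵥ r ⟩) ]      ≡⟨ Σ-remove (λ s → c s * ⟨ w s , -ᵥ r ⟩) j ⟩
      c j * ⟨ w j , -ᵥ r ⟩ + Σ[ (λ i → c (punchIn j i) * ⟨ w (punchIn j i) , -ᵥ r ⟩) ]
                                             ≡⟨ cong (c j * ⟨ w j , -ᵥ r ⟩ +_)
                                                  (Σ-zero (λ i → trans (cong (c (punchIn j i) *_) (-r⊥ i)) (zeroʳ _))) ⟩
      c j * ⟨ w j , -ᵥ r ⟩ + 0#               ≡⟨ +-identityʳ _ ⟩
      c j * ⟨ w j , -ᵥ r ⟩                   ∎))
      (neg*neg (≰⇒> 0≰c[j]) ⟨w[j],-r⟩<0)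
      where open ≡-Reasoning

  noImproving⇒inCone : {z : Vec d} (w : Fin k → Vec d) → LinearlyIndependent w → NoImprovingDirection z w →
                       InCone z w
  noImproving⇒inCone w independent noImproving with noImproving⇒inSpan w noImproving
  ... | c , z≗lc = c , noImproving⇒nonneg w independent noImproving c z≗lc , z≗lc

  generalPosition-restrict : ∀ {m m′} {w : Fin m → Vec d} {w′ : Fin m′ → Vec d} (f : Fin m′ → Fin m) →
                             Injective _≡_ _≡_ f → (∀ i → w′ i ≗ w (f i)) →
                             GeneralPosition w → GeneralPosition w′
  generalPosition-restrict f f-injective w′≗w∘f (independent , no-common-hyperplane) =
    (λ l l≤d h h-injective c lc≗0 → independent l l≤d (f ∘ h) (h-injective ∘ f-injective) c
       (λ t → trans (Σ-cong (λ s → cong (c s *_) (sym (w′≗w∘f (h s) t)))) (lc≗0 t))) ,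
    (λ x h h-injective on-hyperplane → no-common-hyperplane x (f ∘ h) (h-injective ∘ f-injective)
       (λ s → trans (⟨⟩-congˡ x (λ t → sym (w′≗w∘f (h s) t))) (on-hyperplane s)))

module SubsetEnumeration where
  open import Data.Fin.Subset using (Subset; inside; outside; ∣_∣; _∈_)
  open import Data.Vec using ([]; _∷_; here; there)
  open import Data.List as List using (List)
  import Data.List.Membership.Propositional as List
  import Data.List.Membership.Propositional.Properties as List
  open import Data.List.Relation.Unary.Any using () renaming (here to hereˡ)
  private variable
    m : ℕ

  enumerate : (S : Subset m) → Fin ∣ S ∣ → Fin m
  enumerate (inside ∷ S) zero = zero
  enumerate (inside ∷ S) (suc s) = suc (enumerate S s)
  enumerate (outside ∷ S) s = suc (enumerate S s)

  enumerate-∈ : (S : Subset m) (s : Fin ∣ S ∣) → enumerate S s ∈ S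
  enumerate-∈ (inside ∷ S) zero = here
  enumerate-∈ (inside ∷ S) (suc s) = there (enumerate-∈ S s)
  enumerate-∈ (outside ∷ S) s = there (enumerate-∈ S s)

  enumerate-injective : (S : Subset m) → Injective _≡_ _≡_ (enumerate S)
  enumerate-injective (inside ∷ S) {zero} {zero} _ = refl
  enumerate-injective (inside ∷ S) {suc s} {suc s′} e = cong suc (enumerate-injective S (Fin.suc-injective e))
  enumerate-injective (outside ∷ S) e = enumerate-injective S (Fin.suc-injective e)

  enumerate-surjective : (S : Subset m) {i : Fin m} → i ∈ S → Σ (Fin ∣ S ∣) λ s → enumerate S s ≡ i
  enumerate-surjective (inside ∷ S) here = zero , refl
  enumerate-surjective (inside ∷ S) (there i∈S) with enumerate-surjective S i∈S
  ... | s , refl = suc s , refl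
  enumerate-surjective (outside ∷ S) (there i∈S) with enumerate-surjective S i∈S
  ... | s , refl = s , refl

  allSubsets : ∀ m → List (Subset m)
  allSubsets zero = [] List.∷ List.[]
  allSubsets (suc m) = List.map (inside ∷_) (allSubsets m) List.++ List.map (outside ∷_) (allSubsets m)

  ∈-allSubsets : (S : Subset m) → S List.∈ allSubsets m
  ∈-allSubsets [] = hereˡ refl
  ∈-allSubsets (inside ∷ S) = List.∈-++⁺ˡ (List.∈-map⁺ (inside ∷_) (∈-allSubsets S))
  ∈-allSubsets {suc m} (outside ∷ S) =
    List.∈-++⁺ʳ (List.map (inside ∷_) (allSubsets m)) (List.∈-map⁺ (outside ∷_) (∈-allSubsets S))

module LinearProgram (R : RealNumbers) {d m : ℕ} (p : Fin m → UnitLP.Vec R d) (z : UnitLP.Vec R d) where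
  open import Data.Fin.Subset using (Subset; ∣_∣; _∈_; _∉_; _⊂_)
  open import Data.Fin.Subset.Properties using (∣p∣≤n; p⊂q⇒∣p∣<∣q∣)
  import Data.Vec as Vec
  import Data.Vec.Properties as Vec
  open Euclidean R
  open SubsetEnumeration

  Tight : Vec d → Fin m → Set
  Tight x i = ⟨ p i , x ⟩ ≡ 1#

  tightSet : Vec d → Subset m
  tightSet x = Vec.tabulate (λ i → does (⟨ p i , x ⟩ ≟ 1#))

  tight⇒∈ : ∀ {x i} → Tight x i → i ∈ tightSet x
  tight⇒∈ {x} {i} tight =
    Vec.lookup⇒[]= i _ (trans (Vec.lookup∘tabulate _ i) (dec-true (⟨ p i , x ⟩ ≟ 1#) tight))

  ∈⇒tight : ∀ {x i} → i ∈ tightSet x → Tight x i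
  ∈⇒tight {x} {i} i∈T with ⟨ p i , x ⟩ ≟ 1# | trans (sym (Vec.lookup∘tabulate _ i)) (Vec.[]=⇒lookup i∈T)
  ... | yes tight | _ = tight
  ... | no _ | ()

  tightFamily : (x : Vec d) → Fin ∣ tightSet x ∣ → Vec d
  tightFamily x = p ∘ enumerate (tightSet x)

  ⟨,ray⟩ : (q x : Vec d) (t : ℝ) (r : Vec d) → ⟨ q , x +ᵥ t ∙ᵥ r ⟩ ≡ ⟨ q , x ⟩ + t * ⟨ q , r ⟩
  ⟨,ray⟩ q x t r = trans (⟨⟩-+ʳ q x (t ∙ᵥ r)) (cong (⟨ q , x ⟩ +_) (⟨⟩-∙ʳ q t r))

  ray-≤1 : ∀ {q x r t} → ⟨ q , x ⟩ ≤ 1# → ⟨ q , r ⟩ ≤ 0# → 0# ≤ t → ⟨ q , x +ᵥ t ∙ᵥ r ⟩ ≤ 1#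
  ray-≤1 {q} {x} {r} {t} qx≤1 qr≤0 0≤t =
    subst (_≤ 1#) (sym (⟨,ray⟩ q x t r)) (≤-trans (x+y≤x _ (nonneg*nonpos 0≤t qr≤0)) qx≤1)

  ray-feasible : ∀ {x r t} → Feasible p x → (∀ i → ⟨ p i , r ⟩ ≤ 0#) → 0# ≤ t →
                 Feasible p (x +ᵥ t ∙ᵥ r)
  ray-feasible feasible r≤0 0≤t i = ray-≤1 (feasible i) (r≤0 i) 0≤t

  ray-gain : ∀ {x r t} → 0# < t → 0# < ⟨ z , r ⟩ → ⟨ z , x ⟩ < ⟨ z , x +ᵥ t ∙ᵥ r ⟩
  ray-gain {x} {r} {t} 0<t 0<zr = subst (_ <_) (sym (⟨,ray⟩ z x t r)) (x<x+y _ (*-pos 0<t 0<zr))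

  bounded⇒¬improving-ray : ∀ {x r} → Bounded p z → Feasible p x → (∀ i → ⟨ p i , r ⟩ ≤ 0#) →
                           ¬ 0# < ⟨ z , r ⟩
  bounded⇒¬improving-ray {x} {r} (M , bound) feasible r≤0 0<zr =
    ≤⇒≯ (bound _ (ray-feasible feasible r≤0 0≤t)) (subst (M <_) (sym value) (x<x+y M 0<1))
    where
    gap = M - ⟨ z , x ⟩
    t = (gap + 1#) * recip ⟨ z , r ⟩
    0<gap+1 : 0# < gap + 1#
    0<gap+1 = subst (_< gap + 1#) (+-identityˡ 0#) (+-mono-≤-< (x≤y⇒0≤y-x (bound x feasible)) 0<1)
    0≤t : 0# ≤ t
    0≤t = inj₁ (*-pos 0<gap+1 (recip-pos 0<zr))
    value : ⟨ z , x +ᵥ t ∙ᵥ r ⟩ ≡ M + 1#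
    value = begin
      ⟨ z , x +ᵥ t ∙ᵥ r ⟩                                   ≡⟨ ⟨,ray⟩ z x t r ⟩
      ⟨ z , x ⟩ + (gap + 1#) * recip ⟨ z , r ⟩ * ⟨ z , r ⟩  ≡⟨ cong (⟨ z , x ⟩ +_) (a*recip[x]*x≡a (0<x⇒x≢0 0<zr)) ⟩
      ⟨ z , x ⟩ + (M - ⟨ z , x ⟩ + 1#)                      ≡⟨ cancel ⟨ z , x ⟩ M 1# ⟩
      M + 1#                                                 ∎
      where
      open ≡-Reasoning
      cancel : ∀ a M o → a + (M - a + o) ≡ M + o
      cancel = solve 3 (λ a M o → a :+ (M :- a :+ o) := M :+ o) refl

  record RatioStep (x r : Vec d) : Set where
    field
      step : ℝ
      step≥0 : 0# ≤ step
      feasible : Feasible p (x +ᵥ step ∙ᵥ r)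
      blocking : Fin m
      blocking-increases : 0# < ⟨ p blocking , r ⟩
      blocking-tight : Tight (x +ᵥ step ∙ᵥ r) blocking
      step>0 : ¬ Tight x blocking → 0# < step

  -- The step t at which the ray x + t r meets the hyperplane of constraint i, if ⟨ p i , r ⟩ > 0.
  ratio : Vec d → Vec d → Fin m → ℝ
  ratio x r i = (1# - ⟨ p i , x ⟩) * recip ⟨ p i , r ⟩

  ray-reaches-bound : ∀ x r i → 0# < ⟨ p i , r ⟩ → ⟨ p i , x ⟩ + ratio x r i * ⟨ p i , r ⟩ ≡ 1#
  ray-reaches-bound x r i 0<pr = begin
    ⟨ p i , x ⟩ + (1# - ⟨ p i , x ⟩) * recip ⟨ p i , r ⟩ * ⟨ p i , r ⟩  ≡⟨ cong (⟨ p i , x ⟩ +_)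
                                                                           (a*recip[x]*x≡a (0<x⇒x≢0 0<pr)) ⟩
    ⟨ p i , x ⟩ + (1# - ⟨ p i , x ⟩)                                   ≡⟨ cancel ⟨ p i , x ⟩ 1# ⟩
    1#                                                                  ∎
    where
    open ≡-Reasoning
    cancel : ∀ a o → a + (o - a) ≡ o
    cancel = solve 2 (λ a o → a :+ (o :- a) := o) refl

  ratio-test : ∀ {x} r → Feasible p x → (∀ i → ⟨ p i , r ⟩ ≤ 0#) ⊎ RatioStep x r
  ratio-test {x} r feasible with argmin-on (λ i → 0# < ⟨ p i , r ⟩) (λ i → 0# <? ⟨ p i , r ⟩) (ratio x r)
  ... | inj₁ none = inj₁ (λ i → ≮⇒≥ (none i))
  ... | inj₂ (i₀ , 0<p₀r , minimal) = inj₂ record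
    { step = ratio x r i₀
    ; step≥0 = step≥0
    ; feasible = feasible′
    ; blocking = i₀
    ; blocking-increases = 0<p₀r
    ; blocking-tight = trans (⟨,ray⟩ (p i₀) x (ratio x r i₀) r) (ray-reaches-bound x r i₀ 0<p₀r)
    ; step>0 = λ ¬tight → *-pos (x<y⇒0<y-x (≤∧≢⇒< (feasible i₀) ¬tight)) (recip-pos 0<p₀r)
    }
    where
    step≥0 : 0# ≤ ratio x r i₀
    step≥0 = *-nonneg (x≤y⇒0≤y-x (feasible i₀)) (inj₁ (recip-pos 0<p₀r))
    feasible′ : Feasible p (x +ᵥ ratio x r i₀ ∙ᵥ r)
    feasible′ i with 0# <? ⟨ p i , r ⟩
    ... | yes 0<pr = subst (_≤ 1#) (sym (⟨,ray⟩ (p i) x (ratio x r i₀) r))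
          (subst (⟨ p i , x ⟩ + ratio x r i₀ * ⟨ p i , r ⟩ ≤_) (ray-reaches-bound x r i 0<pr)
            (+-monoˡ-≤ ⟨ p i , x ⟩ (*-monoʳ-≤ (inj₁ 0<pr) (minimal i 0<pr))))
    ... | no 0≮pr = ray-≤1 (feasible i) (≮⇒≥ 0≮pr) step≥0

  FeasibleDirection : Vec d → Vec d → Set
  FeasibleDirection x r = ∀ i → Tight x i → ⟨ p i , r ⟩ ≤ 0#

  optimal⇒¬improving : ∀ {x r} → Optimal p z x → FeasibleDirection x r → ¬ 0# < ⟨ z , r ⟩
  optimal⇒¬improving {x} {r} (feasible , maximal) r-feasible 0<zr with ratio-test r feasible
  ... | inj₁ r≤0 = ≤⇒≯ (maximal _ (ray-feasible feasible r≤0 (inj₁ 0<1))) (ray-gain 0<1 0<zr)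
  ... | inj₂ s = ≤⇒≯ (maximal _ (RatioStep.feasible s)) (ray-gain (RatioStep.step>0 s blocking-slack) 0<zr)
    where
    blocking-slack : ¬ Tight x (RatioStep.blocking s)
    blocking-slack tight = ≤⇒≯ (r-feasible _ tight) (RatioStep.blocking-increases s)

  optimal⇒noImproving : ∀ {x} → Optimal p z x → NoImprovingDirection z (tightFamily x)
  optimal⇒noImproving {x} optimal r r≤0 = optimal⇒¬improving optimal r-feasible
    where
    r-feasible : FeasibleDirection x r
    r-feasible i tight with enumerate-surjective (tightSet x) (tight⇒∈ tight)
    ... | s , refl = r≤0 s

  origin-feasible : Feasible p zeroV
  origin-feasible i = subst (_≤ 1#) (sym (⟨⟩-zeroʳ (p i))) (inj₁ 0<1)

  midpoint : Vec d → Vec d → Vec d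
  midpoint x y = half ∙ᵥ (x +ᵥ y)

  ⟨,midpoint⟩ : ∀ q x y → ⟨ q , midpoint x y ⟩ ≡ half * (⟨ q , x ⟩ + ⟨ q , y ⟩)
  ⟨,midpoint⟩ q x y = trans (⟨⟩-∙ʳ q half (x +ᵥ y)) (cong (half *_) (⟨⟩-+ʳ q x y))

  midpoint-optimal : ∀ {x y} → Optimal p z x → Optimal p z y → Optimal p z (midpoint x y)
  midpoint-optimal {x} {y} (feasible-x , maximal-x) (feasible-y , maximal-y) =
    (λ i → subst (_≤ 1#) (sym (⟨,midpoint⟩ (p i) x y)) (average-≤ (feasible-x i) (feasible-y i))) ,
    (λ w feasible-w → subst (⟨ z , w ⟩ ≤_) (sym value) (maximal-x w feasible-w))
    where
    value : ⟨ z , midpoint x y ⟩ ≡ ⟨ z , x ⟩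
    value = trans (⟨,midpoint⟩ z x y) (trans (cong (λ v → half * (⟨ z , x ⟩ + v))
                    (≤-antisym (maximal-x y feasible-y) (maximal-y x feasible-x))) (half*[x+x]≡x _))

  midpoint-tight⇒tight : ∀ {x y i} → Feasible p x → Feasible p y → Tight (midpoint x y) i → Tight x i × Tight y i
  midpoint-tight⇒tight {x} {y} {i} feasible-x feasible-y tight =
    average-≡⇒≡ (feasible-x i) (feasible-y i) average≡1 ,
    average-≡⇒≡ (feasible-y i) (feasible-x i) (trans (cong (half *_) (+-comm _ _)) average≡1)
    where
    average≡1 = trans (sym (⟨,midpoint⟩ (p i) x y)) tight

  numb⇒optimal-satisfies : ∀ {c x} → NumbSet p z c → Bounded p z → Optimal p z x → ⟨ c , x ⟩ ≤ 1#
  numb⇒optimal-satisfies {x = x} (_ , optimal⇔) bounded optimal =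
    proj₁ (Equivalence.to (optimal⇔ bounded x) optimal) zero

  module _ (gp : GeneralPosition (addOne p z)) where

    independent : ∀ {k} → k ℕ.≤ d → (f : Fin k → Fin m) → Injective _≡_ _≡_ f → LinearlyIndependent (p ∘ f)
    independent k≤d f f-injective = proj₁ gp _ k≤d (suc ∘ f) (f-injective ∘ Fin.suc-injective)

    z∉span : ∀ {k} → k ℕ.< d → (f : Fin k → Fin m) → Injective _≡_ _≡_ f → ¬ InSpan z (p ∘ f)
    z∉span k<d f f-injective = independent⇒∉span (addOne p z ∘ lift 1 f)
      (proj₁ gp _ k<d (lift 1 f) (Fin.lift-injective f f-injective 1)) zero

    ∣tightSet∣≤d : ∀ x → ∣ tightSet x ∣ ℕ.≤ d
    ∣tightSet∣≤d x with ∣ tightSet x ∣ ℕ.≤? d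
    ... | yes count≤d = count≤d
    ... | no count≰d = contradiction (λ j → ∈⇒tight (enumerate-∈ _ _)) (proj₂ gp x f f-injective)
      where
      d<count = ℕ.≰⇒> count≰d
      f : Fin (suc d) → Fin (suc m)
      f j = suc (enumerate (tightSet x) (inject≤ j d<count))
      f-injective : Injective _≡_ _≡_ f
      f-injective = Fin.inject≤-injective _ _ _ _ ∘ enumerate-injective _ ∘ Fin.suc-injective

    TightBasis : Vec d → Set
    TightBasis x = Σ (Fin d → Fin m) λ g → Injective _≡_ _≡_ g × ∀ s → Tight x (g s)

    tightBasis : ∀ {x} → d ℕ.≤ ∣ tightSet x ∣ → TightBasis x
    tightBasis {x} d≤count =
      (λ s → enumerate (tightSet x) (inject≤ s d≤count)) ,
      Fin.inject≤-injective _ _ _ _ ∘ enumerate-injective _ ,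
      λ s → ∈⇒tight (enumerate-∈ _ _)

    tight-on-basis⇒≗ : ∀ {x y} (g : Fin d → Fin m) → Injective _≡_ _≡_ g →
                       (∀ s → Tight x (g s)) → (∀ s → Tight y (g s)) → x ≗ y
    tight-on-basis⇒≗ {x} {y} g g-injective tight-x tight-y t =
      x-y≡0⇒x≡y (orthogonal-to-independent⇒≗0 (p ∘ g) (independent ℕ.≤-refl g g-injective) x-y⊥ t)
      where
      x-y⊥ : ∀ s → ⟨ p (g s) , x -ᵥ y ⟩ ≡ 0#
      x-y⊥ s = trans (⟨⟩--ʳ _ x y) (trans (cong₂ _-_ (tight-x s) (tight-y s)) (-‿inverseʳ 1#))

    optimal⇒d≤∣tightSet∣ : ∀ {x} → Optimal p z x → d ℕ.≤ ∣ tightSet x ∣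
    optimal⇒d≤∣tightSet∣ {x} optimal with d ℕ.≤? ∣ tightSet x ∣
    ... | yes d≤count = d≤count
    ... | no d≰count = contradiction (noImproving⇒inSpan (tightFamily x) (optimal⇒noImproving optimal))
                                     (z∉span (ℕ.≰⇒> d≰count) _ (enumerate-injective _))

    optimal⇒inCone : ∀ {x} → Optimal p z x → InCone z (tightFamily x)
    optimal⇒inCone {x} optimal = noImproving⇒inCone (tightFamily x)
      (independent (∣tightSet∣≤d x) _ (enumerate-injective _)) (optimal⇒noImproving optimal)

    optimal-unique : ∀ {x y} → Optimal p z x → Optimal p z y → x ≗ y
    optimal-unique optimal-x optimal-y = tight-on-basis⇒≗ g g-injective (proj₁ ∘ tight-both) (proj₂ ∘ tight-both)
      where
      basis = tightBasis (optimal⇒d≤∣tightSet∣ (midpoint-optimal optimal-x optimal-y))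
      g = proj₁ basis
      g-injective = proj₁ (proj₂ basis)
      tight-both = λ s → midpoint-tight⇒tight (proj₁ optimal-x) (proj₁ optimal-y) (proj₂ (proj₂ basis) s)

    Vertex : Vec d → Set
    Vertex x = Feasible p x × d ℕ.≤ ∣ tightSet x ∣

    Ascent : Vec d → Set
    Ascent y = Σ (Vec d) λ y′ → Feasible p y′ × ⟨ z , y ⟩ ≤ ⟨ z , y′ ⟩ × tightSet y ⊂ tightSet y′

    -- Follow a direction orthogonal to the tight constraints along which z increases (z is not in
    -- their span) until a further constraint becomes tight.
    ascent : ∀ {y} → Bounded p z → Feasible p y → ∣ tightSet y ∣ ℕ.< d → Ascent y
    ascent {y} bounded feasible few-tight with span-or-separating z (tightFamily y)
    ... | inj₁ inSpan = contradiction inSpan (z∉span few-tight _ (enumerate-injective _))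
    ... | inj₂ (r , r⊥ , 0<zr) with ratio-test r feasible
    ...   | inj₁ r≤0 = contradiction 0<zr (bounded⇒¬improving-ray bounded feasible r≤0)
    ...   | inj₂ ratioStep = y +ᵥ step ∙ᵥ r , RatioStep.feasible ratioStep , gain ,
                             (stays-tight , blocking , tight⇒∈ blocking-tight , blocking-slack)
      where
      open RatioStep ratioStep hiding (feasible)
      r⊥tight : ∀ {i} → Tight y i → ⟨ p i , r ⟩ ≡ 0#
      r⊥tight tight with enumerate-surjective _ (tight⇒∈ tight)
      ... | s , refl = r⊥ s
      stays-tight : ∀ {i} → i ∈ tightSet y → i ∈ tightSet (y +ᵥ step ∙ᵥ r)
      stays-tight {i} i∈T = tight⇒∈ (begin
        ⟨ p i , y +ᵥ step ∙ᵥ r ⟩       ≡⟨ ⟨,ray⟩ (p i) y step r ⟩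
        ⟨ p i , y ⟩ + step * ⟨ p i , r ⟩ ≡⟨ cong₂ (λ a b → a + step * b) (∈⇒tight i∈T) (r⊥tight (∈⇒tight i∈T)) ⟩
        1# + step * 0#                 ≡⟨ trans (cong (1# +_) (zeroʳ step)) (+-identityʳ 1#) ⟩
        1#                             ∎)
        where open ≡-Reasoning
      blocking-slack : blocking ∉ tightSet y
      blocking-slack b∈T = <-irrefl (subst (0# <_) (r⊥tight (∈⇒tight b∈T)) blocking-increases)
      gain : ⟨ z , y ⟩ ≤ ⟨ z , y +ᵥ step ∙ᵥ r ⟩
      gain = subst₂ _≤_ (+-identityʳ _) (sym (⟨,ray⟩ z y step r)) (+-monoˡ-≤ _ (*-nonneg step≥0 (inj₁ 0<zr)))

    VertexAbove : Vec d → Set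
    VertexAbove y = Σ (Vec d) λ x → Vertex x × ⟨ z , y ⟩ ≤ ⟨ z , x ⟩

    -- Each ascent makes one more constraint tight, so the fuel m suffices.
    climb : ∀ {y} → Bounded p z → Feasible p y → VertexAbove y
    climb bounded feasible = climb-within m feasible (ℕ.m≤m+n m _)
      where
      climb-within : ∀ fuel {y} → Feasible p y → m ℕ.≤ fuel ℕ.+ ∣ tightSet y ∣ → VertexAbove y
      climb-within fuel {y} feasible bound with d ℕ.≤? ∣ tightSet y ∣
      ... | yes d≤count = y , (feasible , d≤count) , ≤-refl
      ... | no d≰count = continue fuel bound (ascent bounded feasible (ℕ.≰⇒> d≰count))
        where
        continue : ∀ fuel → m ℕ.≤ fuel ℕ.+ ∣ tightSet y ∣ → Ascent y → VertexAbove y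
        continue zero bound (y′ , _ , _ , grows) =
          contradiction bound (ℕ.<⇒≱ (ℕ.<-≤-trans (p⊂q⇒∣p∣<∣q∣ grows) (∣p∣≤n (tightSet y′))))
        continue (suc fuel) bound (y′ , feasible′ , gain , grows) =
          let (x , vertex , y′≤x) = climb-within fuel feasible′ bound′ in x , vertex , ≤-trans gain y′≤x
          where
          bound′ : m ℕ.≤ fuel ℕ.+ ∣ tightSet y′ ∣
          bound′ = ℕ.≤-trans bound (subst (ℕ._≤ fuel ℕ.+ ∣ tightSet y′ ∣) (ℕ.+-suc fuel _)
                                          (ℕ.+-monoʳ-≤ fuel (p⊂q⇒∣p∣<∣q∣ grows)))

    vertex-value-determined : ∀ {x y} → Vertex x → Vertex y → tightSet x ≡ tightSet y → ⟨ z , x ⟩ ≡ ⟨ z , y ⟩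
    vertex-value-determined (_ , d≤count) _ T≡T with tightBasis d≤count
    ... | g , g-injective , tight-x = ⟨⟩-congʳ z (tight-on-basis⇒≗ g g-injective tight-x
                                         (λ s → ∈⇒tight (subst (g s ∈_) T≡T (tight⇒∈ (tight-x s)))))

    bounded⇒¬¬optimal : Bounded p z → ¬ ¬ Σ (Vec d) (Optimal p z)
    bounded⇒¬¬optimal bounded = do
      (x , vertex , maximal) ← ¬¬-maximum Vertex (λ x → ⟨ z , x ⟩) tightSet vertex-value-determined
                                 (allSubsets m) (∈-allSubsets ∘ tightSet) (x₀ , vertex₀)
      return (x , proj₁ vertex , λ y feasible → let (x′ , vertex′ , y≤x′) = climb bounded feasible
                                                in ≤-trans y≤x′ (maximal x′ vertex′))
      where
      start = climb bounded origin-feasible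
      x₀ = proj₁ start
      vertex₀ = proj₁ (proj₂ start)

module Concatenation (R : RealNumbers) {d n k : ℕ} (a : Fin n → UnitLP.Vec R d) (b : Fin k → UnitLP.Vec R d)
                     (z : UnitLP.Vec R d) where
  open Euclidean R
  private
    module A = LinearProgram R a z
    module B = LinearProgram R (a ++ᶜ b) z

  ++-↑ˡ : ∀ i → (a ++ᶜ b) (i ↑ˡ k) ≡ a i
  ++-↑ˡ i = cong [ a , b ]′ (Fin.splitAt-↑ˡ n i k)

  ++-↑ʳ : ∀ j → (a ++ᶜ b) (n ↑ʳ j) ≡ b j
  ++-↑ʳ j = cong [ a , b ]′ (Fin.splitAt-↑ʳ n k j)

  ↑ˡ≢↑ʳ : ∀ i j → i ↑ˡ k ≢ n ↑ʳ j
  ↑ˡ≢↑ʳ i j e =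
    case trans (sym (Fin.splitAt-↑ˡ n i k)) (trans (cong (splitAt n) e) (Fin.splitAt-↑ʳ n k j)) of λ ()

  feasible-++⁻ˡ : ∀ {x} → Feasible (a ++ᶜ b) x → Feasible a x
  feasible-++⁻ˡ {x} feasible i = subst (λ q → ⟨ q , x ⟩ ≤ 1#) (++-↑ˡ i) (feasible (i ↑ˡ k))

  feasible-++⁻ʳ : ∀ {x} → Feasible (a ++ᶜ b) x → Feasible b x
  feasible-++⁻ʳ {x} feasible j = subst (λ q → ⟨ q , x ⟩ ≤ 1#) (++-↑ʳ j) (feasible (n ↑ʳ j))

  feasible-++⁺ : ∀ {x} → Feasible a x → Feasible b x → Feasible (a ++ᶜ b) x
  feasible-++⁺ feasible-a feasible-b i with splitAt n i
  ... | inj₁ i′ = feasible-a i′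
  ... | inj₂ j = feasible-b j

  bounded-++⁺ : Bounded a z → Bounded (a ++ᶜ b) z
  bounded-++⁺ (M , bound) = M , λ x feasible → bound x (feasible-++⁻ˡ feasible)

  optimal-++⁺ : ∀ {x} → Optimal a z x → Feasible b x → Optimal (a ++ᶜ b) z x
  optimal-++⁺ (feasible-a , maximal) feasible-b =
    feasible-++⁺ feasible-a feasible-b , λ y feasible → maximal y (feasible-++⁻ˡ feasible)

  optimal-++⁻ : ∀ {x} → Optimal (a ++ᶜ b) z x → (∀ j → ⟨ b j , x ⟩ < 1#) → Optimal a z x
  optimal-++⁻ {x} optimal slack = feasible-++⁻ˡ (proj₁ optimal) , λ w feasible-w →
    ≮⇒≥ (λ gain → B.optimal⇒¬improving optimal (towards w feasible-w)
                    (subst (0# <_) (sym (⟨⟩--ʳ z w x)) (x<y⇒0<y-x gain)))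
    where
    towards : ∀ w → Feasible a w → B.FeasibleDirection x (w -ᵥ x)
    towards w feasible-w i tight with splitAt n i
    ... | inj₁ i′ = subst (_≤ 0#) (sym (trans (⟨⟩--ʳ (a i′) w x) (cong (_-_ ⟨ a i′ , w ⟩) tight)))
                      (x≤y⇒x-y≤0 (feasible-w i′))
    ... | inj₂ j = ⊥-elim (<-irrefl (subst (_< 1#) tight (slack j)))

  module _ (gp-a : GeneralPosition (addOne a z)) where

    -- The optima of a exist only up to double negation; this suffices because
    -- everything extracted from them below is a (stable) inequality.
    equivalent-++ : (Bounded (a ++ᶜ b) z → ¬ ¬ Bounded a z) →
                    (Bounded a z → ∀ x → Optimal a z x → Feasible b x) →
                    Equivalent (a ++ᶜ b) a z
    equivalent-++ ¬¬bounded optima-feasible = mk⇔ bounded bounded-++⁺ , optimal⇔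
      where
      bounded : Bounded (a ++ᶜ b) z → Bounded a z
      bounded (M , bound) = M , λ y feasible → decidable-stable (⟨ z , y ⟩ ≤? M) (do
        bounded-a ← ¬¬bounded (M , bound)
        (x , optimal) ← A.bounded⇒¬¬optimal gp-a bounded-a
        return (≤-trans (proj₂ optimal y feasible)
                        (bound x (feasible-++⁺ (proj₁ optimal) (optima-feasible bounded-a x optimal)))))
      optimal⇔ : Bounded (a ++ᶜ b) z → ∀ x → Optimal (a ++ᶜ b) z x ⇔ Optimal a z x
      optimal⇔ bounded-ab x = mk⇔ to (λ optimal-a → optimal-++⁺ optimal-a (optima-feasible bounded-a x optimal-a))
        where
        bounded-a = bounded bounded-ab
        to : Optimal (a ++ᶜ b) z x → Optimal a z x
        to optimal = feasible-++⁻ˡ (proj₁ optimal) , λ w feasible → decidable-stable (⟨ z , w ⟩ ≤? ⟨ z , x ⟩) (do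
          (x̂ , optimal-a) ← A.bounded⇒¬¬optimal gp-a bounded-a
          let feasible-x̂ = feasible-++⁺ (proj₁ optimal-a) (optima-feasible bounded-a x̂ optimal-a)
          return (≤-trans (proj₂ optimal-a w feasible) (proj₂ optimal x̂ feasible-x̂)))

module Proposition (R : RealNumbers) {d n k : ℕ} (a : Fin n → UnitLP.Vec R d) (b : Fin k → UnitLP.Vec R d)
                   (z : UnitLP.Vec R d) (gp : UnitLP.GeneralPosition R (UnitLP.addOne R (UnitLP._++ᶜ_ R a b) z)) where
  open Euclidean R
  open Concatenation R a b z
  private
    module A = LinearProgram R a z
    module B = LinearProgram R (a ++ᶜ b) z

  gp-a : GeneralPosition (addOne a z)
  gp-a = generalPosition-restrict {w = addOne (a ++ᶜ b) z} (lift 1 (_↑ˡ k))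
           (Fin.lift-injective _ (Fin.↑ˡ-injective k _ _) 1) pointwise gp
    where
    pointwise : ∀ i → addOne a z i ≗ addOne (a ++ᶜ b) z (lift 1 (_↑ˡ k) i)
    pointwise zero t = refl
    pointwise (suc i) t = cong (λ q → q t) (sym (++-↑ˡ i))

  -- A tight added constraint would be a (d+1)-st constraint tight at x, besides the
  -- d constraints of a that are tight at the optimum x of a.
  equivalent⇒slack : Equivalent (a ++ᶜ b) a z → ∀ x → Optimal (a ++ᶜ b) z x → ∀ j → ⟨ b j , x ⟩ < 1#
  equivalent⇒slack (_ , optimal⇔) x optimal j = ≤∧≢⇒< (feasible-++⁻ʳ (proj₁ optimal) j) b[j]-slack
    where
    optimal-a = Equivalence.to (optimal⇔ (⟨ z , x ⟩ , proj₂ optimal) x) optimal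
    basis = A.tightBasis gp-a (A.optimal⇒d≤∣tightSet∣ gp-a optimal-a)
    g = proj₁ basis
    g-injective = proj₁ (proj₂ basis)
    b[j]-slack : ⟨ b j , x ⟩ ≢ 1#
    b[j]-slack b[j]-tight = proj₂ gp x f f-injective all-tight
      where
      f : Fin (suc d) → Fin (suc (n ℕ.+ k))
      f zero = suc (n ↑ʳ j)
      f (suc s) = suc (g s ↑ˡ k)
      f-injective : ∀ {s s′} → f s ≡ f s′ → s ≡ s′
      f-injective {zero} {zero} _ = refl
      f-injective {zero} {suc s′} e = ⊥-elim (↑ˡ≢↑ʳ _ j (sym (Fin.suc-injective e)))
      f-injective {suc s} {zero} e = ⊥-elim (↑ˡ≢↑ʳ _ j (Fin.suc-injective e))
      f-injective {suc s} {suc s′} e = cong suc (g-injective (Fin.↑ˡ-injective k _ _ (Fin.suc-injective e)))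
      all-tight : ∀ s → ⟨ addOne (a ++ᶜ b) z (f s) , x ⟩ ≡ 1#
      all-tight zero = trans (cong (λ q → ⟨ q , x ⟩) (++-↑ʳ j)) b[j]-tight
      all-tight (suc s) = trans (cong (λ q → ⟨ q , x ⟩) (++-↑ˡ (g s))) (proj₂ (proj₂ basis) s)

  unbounded⇒equivalent : ¬ Bounded (a ++ᶜ b) z → Equivalent (a ++ᶜ b) a z
  unbounded⇒equivalent unbounded = mk⇔ (⊥-elim ∘ unbounded) bounded-++⁺ , ⊥-elim ∘ unbounded

  slack⇒equivalent : (∀ x → Optimal (a ++ᶜ b) z x → ∀ j → ⟨ b j , x ⟩ < 1#) → Equivalent (a ++ᶜ b) a z
  slack⇒equivalent slack = equivalent-++ gp-a ¬¬bounded optima-feasible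
    where
    ¬¬bounded : Bounded (a ++ᶜ b) z → ¬ ¬ Bounded a z
    ¬¬bounded bounded = ¬¬-map (λ (x , optimal) → ⟨ z , x ⟩ , proj₂ (optimal-++⁻ optimal (slack x optimal)))
                               (B.bounded⇒¬¬optimal gp bounded)
    optima-feasible : Bounded a z → ∀ x → Optimal a z x → Feasible b x
    optima-feasible bounded x optimal-a j = decidable-stable (⟨ b j , x ⟩ ≤? 1#) (do
      (x′ , optimal) ← B.bounded⇒¬¬optimal gp (bounded-++⁺ bounded)
      let x′≗x = A.optimal-unique gp-a (optimal-++⁻ optimal (slack x′ optimal)) optimal-a
      return (inj₁ (subst (_< 1#) (⟨⟩-congʳ (b j) x′≗x) (slack x′ optimal j))))

  aPart bPart : Fin (n ℕ.+ k) → Vec d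
  aPart i = [ a , (λ _ → zeroV) ]′ (splitAt n i)
  bPart i = [ (λ _ → zeroV) , b ]′ (splitAt n i)

  ⟨++,⟩-split : ∀ i y → ⟨ (a ++ᶜ b) i , y ⟩ ≡ ⟨ aPart i , y ⟩ + ⟨ bPart i , y ⟩
  ⟨++,⟩-split i y with splitAt n i
  ... | inj₁ i′ = sym (trans (cong (⟨ a i′ , y ⟩ +_) (⟨⟩-zeroˡ y)) (+-identityʳ _))
  ... | inj₂ j = sym (trans (cong (_+ ⟨ b j , y ⟩) (⟨⟩-zeroˡ y)) (+-identityˡ _))

  ⟨aPart,⟩≤1 : ∀ {y} → Feasible a y → ∀ i → ⟨ aPart i , y ⟩ ≤ 1#
  ⟨aPart,⟩≤1 {y} feasible i with splitAt n i
  ... | inj₁ i′ = feasible i′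
  ... | inj₂ j = subst (_≤ 1#) (sym (⟨⟩-zeroˡ y)) (inj₁ 0<1)

  ⟨bPart,⟩≤0 : ∀ {v} → (∀ j → ⟨ v , b j ⟩ ≤ 0#) → ∀ i → ⟨ bPart i , v ⟩ ≤ 0#
  ⟨bPart,⟩≤0 {v} v·b≤0 i with splitAt n i
  ... | inj₁ i′ = inj₂ (⟨⟩-zeroˡ v)
  ... | inj₂ j = subst (_≤ 0#) (⟨⟩-comm v (b j)) (v·b≤0 j)

  -- cv is the part of a cone certificate z = Σ c s · (a ++ b) (g s) contributed by b; together
  -- with a it bounds the objective by Σ c + 1.
  numb⇒equivalent : (Σ (Vec d) λ v → NumbHalfSpace a z v × (∀ j → ⟨ v , b j ⟩ ≤ 0#)) → Equivalent (a ++ᶜ b) a z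
  numb⇒equivalent (v , (_ , numb) , v·b≤0) = equivalent-++ gp-a ¬¬bounded optima-feasible
    where
    optima-feasible : Bounded a z → ∀ x → Optimal a z x → Feasible b x
    optima-feasible bounded x optimal j = A.numb⇒optimal-satisfies (numb (b j) (v·b≤0 j)) bounded optimal
    cone⇒bounded : ∀ {l} (g : Fin l → Fin (n ℕ.+ k)) → InCone z ((a ++ᶜ b) ∘ g) → Bounded a z
    cone⇒bounded g (c , c≥0 , z≗lc) = Equivalence.from (proj₁ (numb cv v·cv≤0)) (Σ[ c ] + 1# , bound)
      where
      cv = lc c (bPart ∘ g)
      v·cv≤0 : ⟨ v , cv ⟩ ≤ 0#
      v·cv≤0 = subst (_≤ 0#) (sym (trans (⟨⟩-comm v cv) (⟨lc,⟩ c (bPart ∘ g) v)))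
                 (Σ-nonpos (λ s → nonneg*nonpos (c≥0 s) (⟨bPart,⟩≤0 v·b≤0 (g s))))
      bound : ∀ y → Feasible (addOne a cv) y → ⟨ z , y ⟩ ≤ Σ[ c ] + 1#
      bound y feasible = subst (_≤ Σ[ c ] + 1#) (sym value) (+-mono-≤ (Σ-mono-≤ a-terms≤c) (feasible zero))
        where
        open ≡-Reasoning
        A-term B-term : Fin _ → ℝ
        A-term s = c s * ⟨ aPart (g s) , y ⟩
        B-term s = c s * ⟨ bPart (g s) , y ⟩
        a-terms≤c : ∀ s → A-term s ≤ c s
        a-terms≤c s = subst (A-term s ≤_) (*-identityʳ (c s)) (*-monoˡ-≤ (c≥0 s) (⟨aPart,⟩≤1 (feasible ∘ suc) (g s)))
        value : ⟨ z , y ⟩ ≡ Σ[ A-term ] + ⟨ cv , y ⟩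
        value = begin
          ⟨ z , y ⟩                                   ≡⟨ trans (⟨⟩-congˡ y z≗lc) (⟨lc,⟩ c _ y) ⟩
          Σ[ (λ s → c s * ⟨ (a ++ᶜ b) (g s) , y ⟩) ]  ≡⟨ Σ-cong (λ s → trans (cong (c s *_) (⟨++,⟩-split (g s) y))
                                                                            (distribˡ _ _ _)) ⟩
          Σ[ (λ s → A-term s + B-term s) ]            ≡⟨ Σ-+ A-term B-term ⟩
          Σ[ A-term ] + Σ[ B-term ]                   ≡⟨ cong (Σ[ A-term ] +_) (sym (⟨lc,⟩ c (bPart ∘ g) y)) ⟩
          Σ[ A-term ] + ⟨ cv , y ⟩                    ∎
    ¬¬bounded : Bounded (a ++ᶜ b) z → ¬ ¬ Bounded a z
    ¬¬bounded bounded = ¬¬-map (λ (x , optimal) → cone⇒bounded _ (B.optimal⇒inCone gp optimal))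
                               (B.bounded⇒¬¬optimal gp bounded)

  equivalent⇔unbounded-or-slack :
    Equivalent (a ++ᶜ b) a z ⇔ (¬ Bounded (a ++ᶜ b) z ⊎ (∀ x → Optimal (a ++ᶜ b) z x → ∀ j → ⟨ b j , x ⟩ < 1#))
  equivalent⇔unbounded-or-slack = mk⇔ (inj₂ ∘ equivalent⇒slack) [ unbounded⇒equivalent , slack⇒equivalent ]′

proposition5p3 :
    (R : RealNumbers) (d n : ℕ)
    (a : Fin n → UnitLP.Vec R d) (b : Fin d → UnitLP.Vec R d) (z : UnitLP.Vec R d) →
    UnitLP.GeneralPosition R (UnitLP.addOne R (UnitLP._++ᶜ_ R a b) z) →
    ((Σ (UnitLP.Vec R d) λ v → UnitLP.NumbHalfSpace R a z v ×
        (∀ j → RealNumbers._≤_ R (UnitLP.⟨_,_⟩ R v (b j)) (RealNumbers.0# R))) →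
      UnitLP.Equivalent R (UnitLP._++ᶜ_ R a b) a z)
    ×
    (UnitLP.Equivalent R (UnitLP._++ᶜ_ R a b) a z ⇔
      (¬ UnitLP.Bounded R (UnitLP._++ᶜ_ R a b) z
       ⊎ (∀ x → UnitLP.Optimal R (UnitLP._++ᶜ_ R a b) z x →
            ∀ j → RealNumbers._<_ R (UnitLP.⟨_,_⟩ R (b j) x) (RealNumbers.1# R))))
proposition5p3 R d n a b z gp = numb⇒equivalent , equivalent⇔unbounded-or-slack
  where open Proposition R a b z gp
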